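{- Let $1\le i<j\le n$, $\gamma_1=\sum_{t=i}^{j-1}\alpha_t+2\sum_{t=j}^{n-1}\alpha_t+\beta$, $\gamma_2=2\sum_{t=i}^{n-1}\alpha_t+\beta$, and $\sigma=s_{\alpha_{j-1}}\cdots s_{\alpha_{n-1}}s_\beta s_{\alpha_{n-1}}\cdots s_{\alpha_i}$. Let $w\in\mathbf{W}$ with $w(\gamma_1)<0$, $w(\gamma_2)<0$, and $w=w_1'\sigma w_2'$ with $w_1'\le s_{\alpha_1}\cdots s_{\alpha_{j-2}}$ and $w_2'\le s_{\alpha_{i-2}}\cdots s_{\alpha_1}$. Then: (1) If $\gamma\in\Sigma^+$ satisfies $\mathrm{ht}(\gamma_1)\le\mathrm{ht}(\gamma)<\mathrm{ht}(\gamma_2)$ and $s_{\gamma_2}(\gamma)<0$, then there is an integer $p$ with $i<p\le j$ such that $\gamma=\sum_{t=i}^{p-1}\alpha_t+2\sum_{t=p}^{n-1}\alpha_t+\beta$; moreover, for such a $\gamma$, if $\sigma(\gamma)<0$ then $\gamma=\gamma_1$. (2) If $\gamma\in\Sigma^+$ satisfies $\mathrm{ht}(\gamma)\ge\mathrm{ht}(\gamma_1)$ and $s_{\gamma_2}(\gamma)>0$, then $\sigma(\gamma)>0$.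
   Context: $n>1$. Roots of $\mathrm{Sp}_{2n}$ with respect to the diagonal torus $t=\mathrm{diag}(a_1,\dots,a_n,a_n^{ -1},\dots,a_1^{ -1})$ and upper triangular Borel; simple roots $\alpha_i(t)=a_i/a_{i+1}$ ($1\le i\le n-1$), $\beta(t)=a_n^2$; $\Sigma^+$ the positive roots; $\mathrm{ht}$ the height; $s_\gamma$ the reflection in $\gamma$; $\mathbf{W}$ the Weyl group with Bruhat order $\le$; "$>0$"/"$<0$" means positive/negative root. -}

module Defs where

open import Data.Nat as ℕ using (ℕ; zero; suc; _<?_; _∸_)
open import Data.Nat.Properties using (<⇒≤)
open import Data.Integer as ℤ using (ℤ; +_; -_; _+_; _-_; _*_; ∣_∣)
open import Data.Integer.DivMod using (_/_)
open import Data.Fin using (Fin; toℕ; fromℕ; fromℕ<)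
open import Data.List as List using (List; []; _∷_; _++_; length; applyUpTo; concatMap; reverse)
open import Data.Product using (Σ; Σ-syntax; _×_)
open import Data.Sum using (_⊎_)
open import Relation.Binary.PropositionalEquality using (_≡_; _≢_)
open import Relation.Binary.Construct.Closure.ReflexiveTransitive using (Star)
open import Relation.Nullary using (yes; no)

-- Everything is 0-based internally:
--  * the character lattice X*(T) of the diagonal torus of Sp_2n is ℤ^n,
--    a vector x : Fin n → ℤ being the character t ↦ ∏ a_{l+1}^{x l};
--  * eℕ m is the standard basis vector e_{m+1}  (a_{m+1});
--  * simple roots are indexed by Fin n: index k with k+1 < n is
--    α_{k+1} = e_{k+1} - e_{k+2}; index n-1 is β = 2 e_n.

Vec : ℕ → Set
Vec n = Fin n → ℤ

_≗ᵥ_ : ∀ {n} → Vec n → Vec n → Set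
x ≗ᵥ y = ∀ l → x l ≡ y l

sumFin : ∀ {m} → (Fin m → ℤ) → ℤ
sumFin {zero} f = + 0
sumFin {suc m} f = f Data.Fin.zero + sumFin (λ k → f (Data.Fin.suc k))

sumFinℕ : ∀ {m} → (Fin m → ℕ) → ℕ
sumFinℕ {zero} f = 0
sumFinℕ {suc m} f = f Data.Fin.zero ℕ.+ sumFinℕ (λ k → f (Data.Fin.suc k))

eℕ : ∀ {n} → ℕ → Vec n
eℕ m l with toℕ l ℕ.≟ m
... | yes _ = + 1
... | no _ = + 0

_+ᵥ_ : ∀ {n} → Vec n → Vec n → Vec n
(x +ᵥ y) l = x l + y l

_·ᵥ_ : ∀ {n} → ℤ → Vec n → Vec n
(a ·ᵥ x) l = a * x l

-ᵥ_ : ∀ {n} → Vec n → Vec n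
(-ᵥ x) l = - x l

simpleRoot : ∀ {n} → Fin n → Vec n
simpleRoot {n} k with suc (toℕ k) <? n
... | yes _ = eℕ (toℕ k) +ᵥ (-ᵥ eℕ (suc (toℕ k)))
... | no _  = (+ 2) ·ᵥ eℕ (toℕ k)

IsSign : ℤ → Set
IsSign s = (s ≡ + 1) ⊎ (s ≡ - (+ 1))

IsRoot : ∀ {n} → Vec n → Set
IsRoot {n} v =
  (Σ[ a ∈ Fin n ] Σ[ b ∈ Fin n ] Σ[ s ∈ ℤ ] Σ[ t ∈ ℤ ]
     a ≢ b × IsSign s × IsSign t × v ≗ᵥ ((s ·ᵥ eℕ (toℕ a)) +ᵥ (t ·ᵥ eℕ (toℕ b))))
  ⊎ (Σ[ a ∈ Fin n ] Σ[ s ∈ ℤ ] IsSign s × v ≗ᵥ ((+ 2 * s) ·ᵥ eℕ (toℕ a)))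

-- Elements of the root lattice written in the basis of simple roots,
-- with natural-number coefficients (index k as for simpleRoot).
Coef : ℕ → Set
Coef n = Fin n → ℕ

toVec : ∀ {n} → Coef n → Vec n
toVec c l = sumFin (λ k → (+ c k) * simpleRoot k l)

ht : ∀ {n} → Coef n → ℕ
ht c = sumFinℕ c

Pos : ∀ {n} → Vec n → Set
Pos {n} v = IsRoot v × Σ[ c ∈ Coef n ] v ≗ᵥ toVec c

Neg : ∀ {n} → Vec n → Set
Neg {n} v = IsRoot v × Σ[ c ∈ Coef n ] v ≗ᵥ (-ᵥ toVec c)

-- coefficient vectors of α_t (1 ≤ t ≤ n-1; zero vector otherwise) and β
α̂ : ∀ {n} → ℕ → Coef n
α̂ {n} t k with suc (toℕ k) <? n | suc (toℕ k) ℕ.≟ t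
... | yes _ | yes _ = 1
... | _     | _     = 0

β̂ : ∀ {n} → Coef n
β̂ {n} k with suc (toℕ k) ℕ.≟ n
... | yes _ = 1
... | no _  = 0

_+ᶜ_ : ∀ {n} → Coef n → Coef n → Coef n
(c +ᶜ d) k = c k ℕ.+ d k

_·ᶜ_ : ∀ {n} → ℕ → Coef n → Coef n
(a ·ᶜ c) k = a ℕ.* c k

0ᶜ : ∀ {n} → Coef n
0ᶜ k = 0

sumα : ∀ {n} → ℕ → ℕ → Coef n
sumα a b = List.foldr (λ t acc → α̂ t +ᶜ acc) 0ᶜ (applyUpTo (a ℕ.+_) (b ∸ a))

γ[_,_] : ∀ {n} → ℕ → ℕ → Coef n
γ[_,_] {n} i p = (sumα i p +ᶜ (2 ·ᶜ sumα p n)) +ᶜ β̂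

γ₁ : ∀ {n} → ℕ → ℕ → Coef n
γ₁ {n} i j = (sumα i j +ᶜ (2 ·ᶜ sumα j n)) +ᶜ β̂

γ₂ : ∀ {n} → ℕ → Coef n
γ₂ {n} i = (2 ·ᶜ sumα i n) +ᶜ β̂

dot : ∀ {n} → Vec n → Vec n → ℤ
dot x y = sumFin (λ l → x l * y l)

coroot-pairing : ∀ {n} → Vec n → Vec n → ℤ
coroot-pairing γ x with ∣ dot γ γ ∣
... | zero = + 0
... | suc m = ((+ 2) * dot x γ) / (+ suc m)

refl : ∀ {n} → Vec n → Vec n → Vec n
refl γ x = x +ᵥ (-ᵥ (coroot-pairing γ x ·ᵥ γ))

-- The Weyl group W: elements are words in the simple reflections
-- (generator k : Fin n is the reflection in simpleRoot k), acting on
-- X*(T); two words are the same element of W iff they act identically.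
Word : ℕ → Set
Word n = List (Fin n)

act : ∀ {n} → Word n → Vec n → Vec n
act [] x = x
act (g ∷ u) x = refl (simpleRoot g) (act u x)

_≈W_ : ∀ {n} → Word n → Word n → Set
u ≈W w = ∀ x → act u x ≗ᵥ act w x

IsLength : ∀ {n} → Word n → ℕ → Set
IsLength {n} u k = (Σ[ v ∈ Word n ] length v ≡ k × v ≈W u)
                 × (∀ (v : Word n) → v ≈W u → k ℕ.≤ length v)

BruhatEdge : ∀ {n} → Word n → Word n → Set
BruhatEdge {n} u w =
  (Σ[ c ∈ Coef n ] IsRoot (toVec c) × (∀ x → act w x ≗ᵥ act u (refl (toVec c) x)))
  × (Σ[ k ∈ ℕ ] Σ[ m ∈ ℕ ] IsLength u k × IsLength w m × k ℕ.< m)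

_≤B_ : ∀ {n} → Word n → Word n → Set
_≤B_ {n} u w = Σ[ v ∈ Word n ] Star BruhatEdge u v × v ≈W w

-- Specific words.
-- s_{α_t} as a word (empty if t is not in 1..n-1; only used in range)
sα : ∀ {n} → ℕ → Word n
sα {n} zero = []
sα {n} (suc t) with suc t <? n
... | yes p = fromℕ< (<⇒≤ p) ∷ []
... | no _  = []

sβ : ∀ {n} → Word n
sβ {zero} = []
sβ {suc m} = fromℕ m ∷ []

ascα : ∀ {n} → ℕ → ℕ → Word n
ascα a b = concatMap sα (applyUpTo (a ℕ.+_) (suc b ∸ a))

-- s_{α_a} s_{α_{a-1}} ⋯ s_{α_b}   (a ≥ b; empty if a < b)
descα : ∀ {n} → ℕ → ℕ → Word n
descα a b = reverse (ascα b a)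

σW : ∀ {n} → ℕ → ℕ → Word n
σW {n} i j = ascα (j ∸ 1) (n ∸ 1) ++ (sβ ++ descα (n ∸ 1) i)

module Submission where

-- Characters of the torus are handled through integer coordinate functions
-- F : ℕ → ℤ ('Coords x F').  In coordinates the simple reflection s_{α_k}
-- swaps the entries k and k+1, and the reflection in a long root 2e_a
-- negates entry a.  The coefficient of α_k in x is the partial sum
-- S F (k+1) = F 0 + … + F k (halved for β = 2e_n), so x is a non-negative
-- combination of simple roots iff all its partial sums are ≥ 0 and the
-- last one is even.  Part (1) then classifies, by signs of
-- partial sums, the roots ±e_a±e_b, ±2e_a satisfying its hypotheses;
-- part (2) compares the partial sums of σ(γ) with those of γ and s_{γ₂}(γ).
-- Internally indices are 0-based: i = c+1, j = b+2, n = n'+1.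

open import Defs
open import Data.Nat as ℕ using (ℕ; zero; suc; z≤n; s≤s; _<?_; _∸_; _≤_; _<_)
import Data.Nat.Properties as NP
import Data.Nat.DivMod as ND
open import Data.Nat.Tactic.RingSolver using () renaming (solve-∀ to solveℕ)
open import Data.Integer as ℤ using (ℤ; +_; -[1+_]; -_; _+_; _*_; _-_; ∣_∣; +≤+)
open import Data.Integer.DivMod using (_/_)
import Data.Integer.Properties as ZP
open import Data.Integer.Tactic.RingSolver using (solve-∀)
open import Data.Fin as F using (Fin; toℕ; fromℕ; fromℕ<)
import Data.Fin.Properties as FP
open import Data.List using (List; []; _∷_; _++_; applyUpTo; concatMap; reverse; foldr)
import Data.List.Properties as LP
open import Data.Product using (Σ; Σ-syntax; _×_; _,_; proj₁; proj₂)
open import Data.Sum using (_⊎_; inj₁; inj₂)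
open import Data.Empty using (⊥; ⊥-elim)
open import Relation.Nullary using (¬_; yes; no; Dec)
open import Relation.Binary.Definitions using (tri<; tri≈; tri>)
open import Relation.Binary.PropositionalEquality as Eq
  using (_≡_; _≢_; sym; trans; cong; cong₂; subst) renaming (refl to rfl)
open Eq.≡-Reasoning

E : ℕ → ℕ → ℤ
E zero zero = + 1
E zero (suc m) = + 0
E (suc a) zero = + 0
E (suc a) (suc m) = E a m

E-same : ∀ a → E a a ≡ + 1
E-same zero = rfl
E-same (suc a) = E-same a

E-diff : ∀ a m → m ≢ a → E a m ≡ + 0
E-diff zero zero ne = ⊥-elim (ne rfl)
E-diff zero (suc m) ne = rfl
E-diff (suc a) zero ne = rfl
E-diff (suc a) (suc m) ne = E-diff a m (λ e → ne (cong suc e))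

E-sym : ∀ a m → E a m ≡ E m a
E-sym zero zero = rfl
E-sym zero (suc m) = rfl
E-sym (suc a) zero = rfl
E-sym (suc a) (suc m) = E-sym a m

eℕ-E : ∀ {n} a (l : Fin n) → eℕ a l ≡ E a (toℕ l)
eℕ-E a l with toℕ l ℕ.≟ a
... | yes p rewrite p = sym (E-same a)
... | no q = sym (E-diff a (toℕ l) q)

-- F lists the coordinates of x (entries beyond the dimension are irrelevant).
Coords : ∀ {n} → Vec n → (ℕ → ℤ) → Set
Coords x F = ∀ l → x l ≡ F (toℕ l)

Coords-ext : ∀ {n} (x : Vec n) F G → (∀ m → F m ≡ G m) → Coords x F → Coords x G
Coords-ext x F G e r l = trans (r l) (e (toℕ l))

Coords-ext< : ∀ {n} (x : Vec n) F G → (∀ m → m < n → F m ≡ G m) → Coords x F → Coords x G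
Coords-ext< x F G e r l = trans (r l) (e (toℕ l) (FP.toℕ<n l))

Coords-≗ : ∀ {n} (x y : Vec n) F → x ≗ᵥ y → Coords y F → Coords x F
Coords-≗ x y F e r l = trans (e l) (r l)

Coords-neg : ∀ {n} (x : Vec n) F → Coords x F → Coords (-ᵥ x) (λ m → - F m)
Coords-neg x F r l = cong -_ (r l)

Coords-unique : ∀ {n} (x : Vec n) F G → Coords x F → Coords x G → ∀ m → m < n → F m ≡ G m
Coords-unique x F G rf rg m p = subst (λ z → F z ≡ G z) (FP.toℕ-fromℕ< p)
  (trans (sym (rf (fromℕ< p))) (rg (fromℕ< p)))

sumℕ : ℕ → (ℕ → ℤ) → ℤ
sumℕ zero G = + 0
sumℕ (suc n) G = G 0 + sumℕ n (λ m → G (suc m))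

sumFin-cong : ∀ {n} (f g : Fin n → ℤ) → (∀ k → f k ≡ g k) → sumFin f ≡ sumFin g
sumFin-cong {zero} f g e = rfl
sumFin-cong {suc n} f g e =
  cong₂ _+_ (e F.zero) (sumFin-cong (λ k → f (F.suc k)) (λ k → g (F.suc k)) (λ k → e (F.suc k)))

sumFin-toℕ : ∀ {n} (G : ℕ → ℤ) → sumFin {n} (λ k → G (toℕ k)) ≡ sumℕ n G
sumFin-toℕ {zero} G = rfl
sumFin-toℕ {suc n} G = cong (λ z → G 0 + z) (sumFin-toℕ {n} (λ m → G (suc m)))

sumℕ-cong : ∀ n (G H : ℕ → ℤ) → (∀ m → m < n → G m ≡ H m) → sumℕ n G ≡ sumℕ n H
sumℕ-cong zero G H e = rfl
sumℕ-cong (suc n) G H e = cong₂ _+_ (e 0 (s≤s z≤n)) (sumℕ-cong n _ _ (λ m p → e (suc m) (s≤s p)))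

sumℕ-zero : ∀ n (G : ℕ → ℤ) → (∀ m → G m ≡ + 0) → sumℕ n G ≡ + 0
sumℕ-zero zero G e = rfl
sumℕ-zero (suc n) G e rewrite e 0 | sumℕ-zero n (λ m → G (suc m)) (λ m → e (suc m)) = rfl

sumℕ-+ : ∀ n (G H : ℕ → ℤ) → sumℕ n (λ m → G m + H m) ≡ sumℕ n G + sumℕ n H
sumℕ-+ zero G H = rfl
sumℕ-+ (suc n) G H rewrite sumℕ-+ n (λ m → G (suc m)) (λ m → H (suc m)) =
  interchange (G 0) (H 0) (sumℕ n (λ m → G (suc m))) (sumℕ n (λ m → H (suc m)))
  where
  interchange : ∀ a b c d → a + b + (c + d) ≡ a + c + (b + d)
  interchange = solve-∀

sumℕ-neg : ∀ n (G : ℕ → ℤ) → sumℕ n (λ m → - G m) ≡ - sumℕ n G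
sumℕ-neg zero G = rfl
sumℕ-neg (suc n) G rewrite sumℕ-neg n (λ m → G (suc m)) = sym (ZP.neg-distrib-+ (G 0) _)

sumℕ-delta : ∀ n a (H : ℕ → ℤ) → a < n → sumℕ n (λ m → H m * E a m) ≡ H a
sumℕ-delta (suc n) zero H p
  rewrite sumℕ-zero n (λ m → H (suc m) * E 0 (suc m)) (λ m → ZP.*-zeroʳ (H (suc m))) =
  trans (ZP.+-identityʳ _) (ZP.*-identityʳ (H 0))
sumℕ-delta (suc n) (suc a) H (s≤s p) rewrite ZP.*-zeroʳ (H 0) =
  trans (ZP.+-identityˡ _) (sumℕ-delta n a (λ m → H (suc m)) p)

sumℕ-delta2 : ∀ n a b (H : ℕ → ℤ) → a < n → b < n →
              sumℕ n (λ m → H m * (E a m - E b m)) ≡ H a - H b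
sumℕ-delta2 n a b H pa pb = begin
    sumℕ n (λ m → H m * (E a m - E b m))
      ≡⟨ sumℕ-cong n _ _ (λ m _ → distrib (H m) (E a m) (E b m)) ⟩
    sumℕ n (λ m → H m * E a m + - (H m * E b m))
      ≡⟨ sumℕ-+ n _ _ ⟩
    sumℕ n (λ m → H m * E a m) + sumℕ n (λ m → - (H m * E b m))
      ≡⟨ cong₂ _+_ (sumℕ-delta n a H pa) (trans (sumℕ-neg n _) (cong -_ (sumℕ-delta n b H pb))) ⟩
    H a - H b ∎
  where
  distrib : ∀ h x y → h * (x - y) ≡ h * x + - (h * y)
  distrib = solve-∀

dot-coords : ∀ {n} (x y : Vec n) F G → Coords x F → Coords y G →
             dot x y ≡ sumℕ n (λ m → F m * G m)
dot-coords {n} x y F G rx ry =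
  trans (sumFin-cong _ _ (λ l → cong₂ _*_ (rx l) (ry l))) (sumFin-toℕ {n} (λ m → F m * G m))

[z*d]/d≡z : ∀ z d → (z * + suc d) / + suc d ≡ z
[z*d]/d≡z (+ m) d rewrite sym (ZP.pos-* m (suc d)) | ZP.*-identityˡ (+ (m ℕ.* suc d) ℤ./ℕ suc d) =
  cong +_ (ND.m*n/n≡m m (suc d))
[z*d]/d≡z -[1+ m ] d with ND._%_ (suc (d ℕ.+ m ℕ.* suc d)) (suc d) in eq
... | zero = trans (ZP.*-identityˡ _) (cong (λ x → - (+ x)) (ND.m*n/n≡m (suc m) (suc d)))
... | suc r with () ← trans (sym eq) (ND.m*n%n≡0 (suc m) (suc d))

pairing : ∀ {n} (g x : Vec n) d → ∣ dot g g ∣ ≡ suc d →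
          coroot-pairing g x ≡ ((+ 2) * dot x g) / (+ suc d)
pairing g x d eq with ∣ dot g g ∣
pairing g x d rfl | .(suc d) = rfl

refl-integral : ∀ {n} (g x : Vec n) (c : ℤ) d → ∣ dot g g ∣ ≡ suc d →
                + 2 * dot x g ≡ c * + suc d → ∀ l → refl g x l ≡ x l - c * g l
refl-integral g x c d gg xg l = cong (λ z → x l - z * g l) pairing≡c
  where
  pairing≡c : coroot-pairing g x ≡ c
  pairing≡c = trans (pairing g x d gg) (trans (cong (_/ + suc d) xg) ([z*d]/d≡z c d))

swap : ℕ → ℕ → ℕ
swap zero zero = 1
swap zero (suc zero) = 0
swap zero (suc (suc m)) = suc (suc m)
swap (suc k) zero = zero
swap (suc k) (suc m) = suc (swap k m)

swap-invol : ∀ k m → swap k (swap k m) ≡ m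
swap-invol zero zero = rfl
swap-invol zero (suc zero) = rfl
swap-invol zero (suc (suc m)) = rfl
swap-invol (suc k) zero = rfl
swap-invol (suc k) (suc m) = cong suc (swap-invol k m)

swap-bound : ∀ k m n → suc k < n → m < n → swap k m < n
swap-bound zero zero n p q = p
swap-bound zero (suc zero) n p q = NP.<-trans (s≤s z≤n) q
swap-bound zero (suc (suc m)) n p q = q
swap-bound (suc k) zero n p q = q
swap-bound (suc k) (suc m) (suc n) (s≤s p) (s≤s q) = s≤s (swap-bound k m n p q)

E-swap : ∀ k a m → E a (swap k m) ≡ E (swap k a) m
E-swap k a m with swap k m ℕ.≟ a
... | yes p rewrite sym p | swap-invol k m = trans (E-same (swap k m)) (sym (E-same m))
... | no q = trans (E-diff a (swap k m) q)
                   (sym (E-diff (swap k a) m (λ e → q (trans (cong (swap k) e) (swap-invol k a)))))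

swap-formula : ∀ k m (F : ℕ → ℤ) → F m - (F k - F (suc k)) * (E k m - E (suc k) m) ≡ F (swap k m)
swap-formula zero zero F = ring (F 0) (F 1)
  where ring : ∀ a b → a - (a - b) * (+ 1 - + 0) ≡ b
        ring = solve-∀
swap-formula zero (suc zero) F = ring (F 0) (F 1)
  where ring : ∀ a b → b - (a - b) * (+ 0 - + 1) ≡ a
        ring = solve-∀
swap-formula zero (suc (suc m)) F = ring (F (suc (suc m))) (F 0) (F 1)
  where ring : ∀ a b c → a - (b - c) * (+ 0 - + 0) ≡ a
        ring = solve-∀
swap-formula (suc k) zero F = ring (F 0) (F (suc k)) (F (suc (suc k)))
  where ring : ∀ a b c → a - (b - c) * (+ 0 - + 0) ≡ a
        ring = solve-∀
swap-formula (suc k) (suc m) F = swap-formula k m (λ z → F (suc z))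

simpleRoot-α : ∀ {n} (k : Fin n) → suc (toℕ k) < n →
               Coords (simpleRoot k) (λ m → E (toℕ k) m - E (suc (toℕ k)) m)
simpleRoot-α {n} k p l with suc (toℕ k) <? n
... | yes _ = cong₂ (λ u v → u + - v) (eℕ-E (toℕ k) l) (eℕ-E (suc (toℕ k)) l)
... | no ¬p = ⊥-elim (¬p p)

simpleRoot-β : ∀ {n} (k : Fin n) → ¬ (suc (toℕ k) < n) →
               Coords (simpleRoot k) (λ m → + 2 * E (toℕ k) m)
simpleRoot-β {n} k p l with suc (toℕ k) <? n
... | yes q = ⊥-elim (p q)
... | no _ = cong (+ 2 *_) (eℕ-E (toℕ k) l)

reflα : ∀ {n} (k : Fin n) (x : Vec n) (F : ℕ → ℤ) → suc (toℕ k) < n → Coords x F →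
        Coords (refl (simpleRoot k) x) (λ m → F (swap (toℕ k) m))
reflα {n} k x F p rx l = begin
    refl g x l
      ≡⟨ refl-integral g x (F kk - F (suc kk)) 1 (cong ∣_∣ gg) xg l ⟩
    x l - (F kk - F (suc kk)) * g l
      ≡⟨ cong₂ (λ u v → u - (F kk - F (suc kk)) * v) (rx l) (simpleRoot-α k p l) ⟩
    F m - (F kk - F (suc kk)) * (E kk m - E (suc kk) m)
      ≡⟨ swap-formula kk m F ⟩
    F (swap kk m) ∎
  where
  g = simpleRoot k
  kk = toℕ k
  m = toℕ l
  G : ℕ → ℤ
  G m = E kk m - E (suc kk) m
  kn : kk < n
  kn = NP.<-trans (NP.n<1+n kk) p
  gg : dot g g ≡ + 2
  gg = trans (dot-coords g g G G (simpleRoot-α k p) (simpleRoot-α k p))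
         (trans (sumℕ-delta2 n kk (suc kk) G kn p)
           (cong₂ _-_ (cong₂ _-_ (E-same kk) (E-diff (suc kk) kk (λ e → NP.1+n≢n (sym e))))
                      (cong₂ _-_ (E-diff kk (suc kk) NP.1+n≢n) (E-same (suc kk)))))
  xg : + 2 * dot x g ≡ (F kk - F (suc kk)) * + 2
  xg = trans (cong (+ 2 *_) (trans (dot-coords x g F G rx (simpleRoot-α k p))
                                   (sumℕ-delta2 n kk (suc kk) F kn p)))
             (ZP.*-comm (+ 2) _)

negEntry : ℕ → (ℕ → ℤ) → ℕ → ℤ
negEntry a F m = F m - (+ 2 * F a) * E a m

reflLong : ∀ {n} (a : ℕ) (g x : Vec n) (F : ℕ → ℤ) → a < n →
           Coords g (λ m → + 2 * E a m) → Coords x F →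
           Coords (refl g x) (negEntry a F)
reflLong {n} a g x F p rg rx l = begin
    refl g x l
      ≡⟨ refl-integral g x (F a) 3 (cong ∣_∣ gg) xg l ⟩
    x l - F a * g l
      ≡⟨ cong₂ (λ u v → u - F a * v) (rx l) (rg l) ⟩
    F m - F a * (+ 2 * E a m)
      ≡⟨ regroup (F m) (F a) (E a m) ⟩
    F m - (+ 2 * F a) * E a m ∎
  where
  m = toℕ l
  G : ℕ → ℤ
  G m = + 2 * E a m
  regroup : ∀ u v e → u - v * (+ 2 * e) ≡ u - (+ 2 * v) * e
  regroup = solve-∀
  square : ∀ e → (+ 2 * e) * (+ 2 * e) ≡ (+ 4 * e) * e
  square = solve-∀
  gg : dot g g ≡ + 4
  gg = trans (dot-coords g g G G rg rg)
         (trans (sumℕ-cong n _ _ (λ m _ → square (E a m)))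
           (trans (sumℕ-delta n a (λ m → + 4 * E a m) p) (cong (+ 4 *_) (E-same a))))
  scale : ∀ f e → f * (+ 2 * e) ≡ (+ 2 * f) * e
  scale = solve-∀
  quadruple : ∀ f → + 2 * (+ 2 * f) ≡ f * + 4
  quadruple = solve-∀
  xg : + 2 * dot x g ≡ F a * + 4
  xg = trans (cong (+ 2 *_) (trans (dot-coords x g F G rx rg)
               (trans (sumℕ-cong n _ _ (λ m _ → scale (F m) (E a m)))
                      (sumℕ-delta n a (λ m → + 2 * F m) p))))
             (quadruple (F a))

act-++ : ∀ {n} (u v : Word n) x → act (u ++ v) x ≡ act u (act v x)
act-++ [] v x = rfl
act-++ (g ∷ u) v x = cong (refl (simpleRoot g)) (act-++ u v x)

act-sα : ∀ {n} t (x : Vec n) F → suc t < n → Coords x F →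
         Coords (act (sα (suc t)) x) (λ m → F (swap t m))
act-sα {n} t x F p r with suc t <? n
... | no q = ⊥-elim (q p)
... | yes q = Coords-ext _ _ _ (λ m → cong (λ z → F (swap z m)) (FP.toℕ-fromℕ< (NP.<⇒≤ q)))
                (reflα (fromℕ< (NP.<⇒≤ q)) x F
                       (subst (λ z → suc z < n) (sym (FP.toℕ-fromℕ< (NP.<⇒≤ q))) p) r)

act-sβ : ∀ n' (x : Vec (suc n')) F → Coords x F →
         Coords (act (sβ {suc n'}) x) (negEntry n' F)
act-sβ n' x F r =
  subst (λ z → Coords (act (sβ {suc n'}) x) (negEntry z F)) (FP.toℕ-fromℕ n')
    (reflLong (toℕ (fromℕ n')) (simpleRoot (fromℕ n')) x F (FP.toℕ<n (fromℕ n'))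
      (simpleRoot-β (fromℕ n') (λ p → NP.<-irrefl rfl (subst (λ z → suc z < suc n') (FP.toℕ-fromℕ n') p)))
      r)

sα-reverse : ∀ {n} t → reverse (sα {n} t) ≡ sα t
sα-reverse zero = rfl
sα-reverse {n} (suc t) with suc t <? n
... | yes _ = rfl
... | no _ = rfl

-- The index permutations induced by s_{α_{b+1}} ⋯ s_{α_{b+L}} and by its reverse.
cycleAsc : ℕ → ℕ → ℕ → ℕ
cycleAsc b zero m = m
cycleAsc b (suc L) m = cycleAsc (suc b) L (swap b m)

cycleDesc : ℕ → ℕ → ℕ → ℕ
cycleDesc b zero m = m
cycleDesc b (suc L) m = swap b (cycleDesc (suc b) L m)

-- Coordinates after an ascending product s_{α_{b+1}} ⋯ s_{α_{b+L}}, for any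
-- listing f of the indices b+1, …, b+L (as produced by applyUpTo).
act-asc : ∀ {n} L b (f : ℕ → ℕ) → (∀ k → f k ≡ suc (b ℕ.+ k)) → b ℕ.+ L < n →
          ∀ (x : Vec n) F → Coords x F →
          Coords (act (concatMap sα (applyUpTo f L)) x) (λ m → F (cycleAsc b L m))
act-asc zero b f hf bn x F r = r
act-asc {n} (suc L) b f hf bn x F r =
  subst (λ y → Coords y (λ m → F (cycleAsc b (suc L) m))) (sym (act-++ (sα (f 0)) _ x))
    (subst (λ t → Coords (act (sα t) y) (λ m → F (cycleAsc b (suc L) m))) (sym f0)
      (act-sα b y (λ m → F (cycleAsc (suc b) L m)) sb rest))
  where
  y = act (concatMap sα (applyUpTo (λ k → f (suc k)) L)) x
  f0 : f 0 ≡ suc b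
  f0 = trans (hf 0) (cong suc (NP.+-identityʳ b))
  sb : suc b < n
  sb = NP.≤-<-trans (subst (suc b ≤_) (sym (NP.+-suc b L)) (s≤s (NP.m≤m+n b L))) bn
  rest : Coords y (λ m → F (cycleAsc (suc b) L m))
  rest = act-asc L (suc b) (λ k → f (suc k)) (λ k → trans (hf (suc k)) (cong suc (NP.+-suc b k)))
           (subst (_< n) (NP.+-suc b L) bn) x F r

act-desc : ∀ {n} L b (f : ℕ → ℕ) → (∀ k → f k ≡ suc (b ℕ.+ k)) → b ℕ.+ L < n →
           ∀ (x : Vec n) F → Coords x F →
           Coords (act (reverse (concatMap sα (applyUpTo f L))) x) (λ m → F (cycleDesc b L m))
act-desc zero b f hf bn x F r = r
act-desc {n} (suc L) b f hf bn x F r =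
  subst (λ y → Coords y (λ m → F (cycleDesc b (suc L) m))) (sym unfold)
    (act-desc L (suc b) (λ k → f (suc k)) (λ k → trans (hf (suc k)) (cong suc (NP.+-suc b k)))
       (subst (_< n) (NP.+-suc b L) bn) (act (sα (f 0)) x) (λ m → F (swap b m))
       (subst (λ t → Coords (act (sα t) x) (λ m → F (swap b m))) (sym f0) (act-sα b x F sb r)))
  where
  rest = concatMap sα (applyUpTo (λ k → f (suc k)) L)
  unfold : act (reverse (sα (f 0) ++ rest)) x ≡ act (reverse rest) (act (sα (f 0)) x)
  unfold = trans (cong (λ w → act w x) (trans (LP.reverse-++ (sα (f 0)) rest)
                                              (cong (reverse rest ++_) (sα-reverse (f 0)))))
                 (act-++ (reverse rest) (sα (f 0)) x)
  f0 : f 0 ≡ suc b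
  f0 = trans (hf 0) (cong suc (NP.+-identityʳ b))
  sb : suc b < n
  sb = NP.≤-<-trans (subst (suc b ≤_) (sym (NP.+-suc b L)) (s≤s (NP.m≤m+n b L))) bn

swap-self : ∀ b → swap b b ≡ suc b
swap-self zero = rfl
swap-self (suc b) = cong suc (swap-self b)

swap-suc : ∀ b → swap b (suc b) ≡ b
swap-suc zero = rfl
swap-suc (suc b) = cong suc (swap-suc b)

swap-lt : ∀ b m → m < b → swap b m ≡ m
swap-lt (suc b) zero p = rfl
swap-lt (suc b) (suc m) (s≤s p) = cong suc (swap-lt b m p)

swap-gt : ∀ b m → suc b < m → swap b m ≡ m
swap-gt zero (suc zero) (s≤s ())
swap-gt zero (suc (suc m)) p = rfl
swap-gt (suc b) (suc m) (s≤s p) = cong suc (swap-gt b m p)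

cycleAsc-lt : ∀ L b m → m < b → cycleAsc b L m ≡ m
cycleAsc-lt zero b m p = rfl
cycleAsc-lt (suc L) b m p rewrite swap-lt b m p = cycleAsc-lt L (suc b) m (NP.m<n⇒m<1+n p)

cycleAsc-start : ∀ L b → cycleAsc b L b ≡ b ℕ.+ L
cycleAsc-start zero b = sym (NP.+-identityʳ b)
cycleAsc-start (suc L) b rewrite swap-self b = trans (cycleAsc-start L (suc b)) (sym (NP.+-suc b L))

cycleAsc-mid : ∀ L b m → b ≤ m → m < b ℕ.+ L → cycleAsc b L (suc m) ≡ m
cycleAsc-mid zero b m p q =
  ⊥-elim (NP.<-irrefl rfl (NP.<-≤-trans q (subst (_≤ m) (sym (NP.+-identityʳ b)) p)))
cycleAsc-mid (suc L) b m p q with NP.m≤n⇒m<n∨m≡n p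
... | inj₂ rfl rewrite swap-suc b = cycleAsc-lt L (suc b) b (NP.n<1+n b)
... | inj₁ b<m rewrite swap-gt b (suc m) (s≤s b<m) =
  cycleAsc-mid L (suc b) m b<m (subst (m <_) (NP.+-suc b L) q)

cycleDesc-lt : ∀ L b m → m < b → cycleDesc b L m ≡ m
cycleDesc-lt zero b m p = rfl
cycleDesc-lt (suc L) b m p rewrite cycleDesc-lt L (suc b) m (NP.m<n⇒m<1+n p) = swap-lt b m p

cycleDesc-end : ∀ L b → cycleDesc b L (b ℕ.+ L) ≡ b
cycleDesc-end zero b rewrite NP.+-identityʳ b = rfl
cycleDesc-end (suc L) b rewrite NP.+-suc b L | cycleDesc-end L (suc b) = swap-suc b

cycleDesc-mid : ∀ L b m → b ≤ m → m < b ℕ.+ L → cycleDesc b L m ≡ suc m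
cycleDesc-mid zero b m p q =
  ⊥-elim (NP.<-irrefl rfl (NP.<-≤-trans q (subst (_≤ m) (sym (NP.+-identityʳ b)) p)))
cycleDesc-mid (suc L) b m p q with NP.m≤n⇒m<n∨m≡n p
... | inj₂ rfl rewrite cycleDesc-lt L (suc b) b (NP.n<1+n b) = swap-self b
... | inj₁ b<m rewrite cycleDesc-mid L (suc b) m b<m (subst (m <_) (NP.+-suc b L) q) =
  swap-gt b (suc m) (s≤s b<m)

-- weight n k is the coefficient of e_k in the k-th simple root: 1 for α, 2 for β.
weight : ℕ → ℕ → ℤ
weight n k with suc k <? n
... | yes _ = + 1
... | no _ = + 2

weight-α : ∀ n k → suc k < n → weight n k ≡ + 1
weight-α n k p with suc k <? n
... | yes _ = rfl
... | no q = ⊥-elim (q p)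

weight-β : ∀ n k → ¬ (suc k < n) → weight n k ≡ + 2
weight-β n k p with suc k <? n
... | yes q = ⊥-elim (p q)
... | no _ = rfl

weight-pos : ∀ n k → Σ ℕ λ w → weight n k ≡ + suc w
weight-pos n k with suc k <? n
... | yes _ = 0 , rfl
... | no _ = 1 , rfl

-- Uniform coordinates of the simple roots: weight · e_k − e_{k+1}
-- (for β the second term vanishes inside the dimension).
simpleRoot-coord : ∀ {n} (k l : Fin n) →
                   simpleRoot k l ≡ weight n (toℕ k) * E (toℕ k) (toℕ l) - E (suc (toℕ k)) (toℕ l)
simpleRoot-coord {n} k l = byKind (suc (toℕ k) <? n)
  where
  a = E (toℕ k) (toℕ l)
  a′ = E (suc (toℕ k)) (toℕ l)
  byKind : Dec (suc (toℕ k) < n) → simpleRoot k l ≡ weight n (toℕ k) * a - a′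
  byKind (yes p) rewrite weight-α n (toℕ k) p = trans (simpleRoot-α k p l) (unit a a′)
    where unit : ∀ a b → a - b ≡ + 1 * a - b
          unit = solve-∀
  byKind (no p) rewrite weight-β n (toℕ k) p =
    trans (simpleRoot-β k p l) (trans (sym (ZP.+-identityʳ _)) (cong (λ z → + 2 * a - z) (sym beyond)))
    where
    beyond : a′ ≡ + 0
    beyond = E-diff (suc (toℕ k)) (toℕ l) (λ e → p (subst (_< n) e (FP.toℕ<n l)))

prevCoef : (ℕ → ℕ) → ℕ → ℤ
prevCoef C zero = + 0
prevCoef C (suc m) = + C m

-- The m-th coordinate of Σ_k C k · (k-th simple root).
coefCoord : ℕ → (ℕ → ℕ) → ℕ → ℤ
coefCoord n C m = + C m * weight n m - prevCoef C m

sum-simpleCoord : ∀ n (C : ℕ → ℕ) m → m < n →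
  sumℕ n (λ k → + C k * (weight n k * E k m - E (suc k) m)) ≡ coefCoord n C m
sum-simpleCoord n C m p = begin
    sumℕ n (λ k → + C k * (weight n k * E k m - E (suc k) m))
      ≡⟨ sumℕ-cong n _ _ (λ k _ → trans (distrib (+ C k) (weight n k) (E k m) (E (suc k) m))
                                         (cong (λ z → (+ C k * weight n k) * z + - (+ C k * E (suc k) m))
                                               (E-sym k m))) ⟩
    sumℕ n (λ k → (+ C k * weight n k) * E m k + - (+ C k * E (suc k) m))
      ≡⟨ sumℕ-+ n _ _ ⟩
    sumℕ n (λ k → (+ C k * weight n k) * E m k) + sumℕ n (λ k → - (+ C k * E (suc k) m))
      ≡⟨ cong₂ _+_ (sumℕ-delta n m (λ k → + C k * weight n k) p)
                   (trans (sumℕ-neg n _) (cong -_ (previous m p))) ⟩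
    coefCoord n C m ∎
  where
  distrib : ∀ c w e e' → c * (w * e - e') ≡ (c * w) * e + - (c * e')
  distrib = solve-∀
  previous : ∀ m → m < n → sumℕ n (λ k → + C k * E (suc k) m) ≡ prevCoef C m
  previous zero p = sumℕ-zero n _ (λ k → ZP.*-zeroʳ (+ C k))
  previous (suc m) p =
    trans (sumℕ-cong n _ _ (λ k _ → cong (+ C k *_) (E-sym k m)))
          (sumℕ-delta n m (λ k → + C k) (NP.<-trans (NP.n<1+n m) p))

toVec-coefCoord : ∀ {n} (c : Coef n) (C : ℕ → ℕ) → (∀ k → c k ≡ C (toℕ k)) →
                  Coords (toVec c) (coefCoord n C)
toVec-coefCoord {n} c C hc l =
  trans (sumFin-cong _ _ (λ k → cong₂ (λ u v → + u * v) (hc k) (simpleRoot-coord k l)))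
    (trans (sumFin-toℕ {n} (λ k → + C k * (weight n k * E k (toℕ l) - E (suc k) (toℕ l))))
           (sum-simpleCoord n C (toℕ l) (FP.toℕ<n l)))

coefAt : ∀ {n} → Coef n → ℕ → ℕ
coefAt {n} c m with m <? n
... | yes p = c (fromℕ< p)
... | no _ = 0

coefAt-toℕ : ∀ {n} (c : Coef n) k → c k ≡ coefAt c (toℕ k)
coefAt-toℕ {n} c k with toℕ k <? n
... | yes p = cong c (sym (FP.fromℕ<-toℕ k p))
... | no q = ⊥-elim (q (FP.toℕ<n k))

coords : ∀ {n} → Coef n → ℕ → ℤ
coords {n} c = coefCoord n (coefAt c)

toVec-coords : ∀ {n} (c : Coef n) → Coords (toVec c) (coords c)
toVec-coords c = toVec-coefCoord c (coefAt c) (coefAt-toℕ c)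

S : (ℕ → ℤ) → ℕ → ℤ
S F zero = + 0
S F (suc m) = S F m + F m

S-cong : ∀ (F G : ℕ → ℤ) m → (∀ k → k < m → F k ≡ G k) → S F m ≡ S G m
S-cong F G zero e = rfl
S-cong F G (suc m) e = cong₂ _+_ (S-cong F G m (λ k p → e k (NP.m<n⇒m<1+n p))) (e m (NP.n<1+n m))

S-neg : ∀ (F : ℕ → ℤ) m → S (λ k → - F k) m ≡ - S F m
S-neg F zero = rfl
S-neg F (suc m) rewrite S-neg F m = sym (ZP.neg-distrib-+ (S F m) (F m))

S-Coords : ∀ {n} (x : Vec n) F G → Coords x F → Coords x G → ∀ m → m ≤ n → S F m ≡ S G m
S-Coords x F G rf rg m p = S-cong F G m (λ k q → Coords-unique x F G rf rg k (NP.<-≤-trans q p))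

S-coefCoord : ∀ n C m → m < n → S (coefCoord n C) (suc m) ≡ + C m * weight n m
S-coefCoord n C zero p = ring (+ C 0 * weight n 0)
  where ring : ∀ a → + 0 + (a - + 0) ≡ a
        ring = solve-∀
S-coefCoord n C (suc m) p rewrite S-coefCoord n C m (NP.<-trans (NP.n<1+n m) p) | weight-α n m p =
  ring (+ C m) (+ C (suc m) * weight n (suc m))
  where ring : ∀ a b → a * + 1 + (b - a) ≡ b
        ring = solve-∀

S-coords-nonneg : ∀ {n} (c : Coef n) m → m ≤ n → + 0 ℤ.≤ S (coords c) m
S-coords-nonneg c zero p = ZP.≤-refl
S-coords-nonneg {n} c (suc m) p with weight-pos n m
... | w , e rewrite S-coefCoord n (coefAt c) m p | e | sym (ZP.pos-* (coefAt c m) (suc w)) = +≤+ z≤n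

pos⇒partialSums≥0 : ∀ {n} (v : Vec n) F → Coords v F → (Σ[ c ∈ Coef n ] v ≗ᵥ toVec c) →
                    ∀ m → m ≤ n → + 0 ℤ.≤ S F m
pos⇒partialSums≥0 v F r (c , e) m p =
  subst (+ 0 ℤ.≤_) (sym (S-Coords v F (coords c) r (Coords-≗ v (toVec c) (coords c) e (toVec-coords c)) m p))
    (S-coords-nonneg c m p)

pos⇒total-even : ∀ {n} (v : Vec (suc n)) F → Coords v F → (Σ[ c ∈ Coef (suc n) ] v ≗ᵥ toVec c) →
                 Σ ℕ λ M → S F (suc n) ≡ + M * + 2
pos⇒total-even {n} v F r (c , e) = coefAt c n , (begin
    S F (suc n)
      ≡⟨ S-Coords v F (coords c) r (Coords-≗ v (toVec c) (coords c) e (toVec-coords c)) (suc n) NP.≤-refl ⟩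
    S (coords c) (suc n)
      ≡⟨ S-coefCoord (suc n) (coefAt c) n (NP.n<1+n n) ⟩
    + coefAt c n * weight (suc n) n
      ≡⟨ cong (+ coefAt c n *_) (weight-β (suc n) n (NP.<-irrefl rfl)) ⟩
    + coefAt c n * + 2 ∎)

neg⇒partialSums≤0 : ∀ {n} (v : Vec n) F → Coords v F → (Σ[ c ∈ Coef n ] v ≗ᵥ (-ᵥ toVec c)) →
                    ∀ m → m ≤ n → S F m ℤ.≤ + 0
neg⇒partialSums≤0 v F r (c , e) m p =
  subst (ℤ._≤ + 0) (sym (trans (S-Coords v F (λ k → - coords c k) r negCoords m p) (S-neg (coords c) m)))
    (ZP.neg-mono-≤ (S-coords-nonneg c m p))
  where
  negCoords : Coords v (λ k → - coords c k)
  negCoords = Coords-≗ v (-ᵥ toVec c) (λ k → - coords c k) e (Coords-neg (toVec c) (coords c) (toVec-coords c))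

-- Positivity criterion, sufficiency: coefficients recovered from the partial sums.
coefFromSums : ℕ → (ℕ → ℤ) → ℕ → ℕ → ℕ
coefFromSums n G M m with suc m <? n
... | yes _ = ∣ S G (suc m) ∣
... | no _ = M

coefFromSums-α : ∀ n G M m → suc m < n → coefFromSums n G M m ≡ ∣ S G (suc m) ∣
coefFromSums-α n G M m p with suc m <? n
... | yes _ = rfl
... | no q = ⊥-elim (q p)

pos-fromPartialSums : ∀ {n} (y : Vec n) G M → Coords y G → (∀ m → m ≤ n → + 0 ℤ.≤ S G m) →
                      S G n ≡ + M * + 2 → Σ[ c ∈ Coef n ] y ≗ᵥ toVec c
pos-fromPartialSums {n} y G M r nonneg total = (λ k → C (toℕ k)) , λ l →
  trans (r l) (sym (trans (toVec-coefCoord _ C (λ k → rfl) l) (coefCoord-C (toℕ l) (FP.toℕ<n l))))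
  where
  C = coefFromSums n G M
  current : ∀ m → m < n → + C m * weight n m ≡ S G (suc m)
  current m p with suc m <? n
  ... | yes q = trans (ZP.*-identityʳ _) (ZP.0≤i⇒+∣i∣≡i (nonneg (suc m) (NP.<⇒≤ q)))
  ... | no q = trans (sym total) (cong (S G) (sym (NP.≤-antisym p (NP.≮⇒≥ q))))
  previous : ∀ m → m < n → prevCoef C m ≡ S G m
  previous zero p = rfl
  previous (suc m) p rewrite coefFromSums-α n G M m p = ZP.0≤i⇒+∣i∣≡i (nonneg (suc m) (NP.<⇒≤ p))
  coefCoord-C : ∀ m → m < n → coefCoord n C m ≡ G m
  coefCoord-C m p = trans (cong₂ _-_ (current m p) (previous m p)) (ring (S G m) (G m))
    where ring : ∀ a b → a + b - a ≡ b
          ring = solve-∀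

toVec-injective : ∀ {n} (c d : Coef n) → toVec c ≗ᵥ toVec d → ∀ k → c k ≡ d k
toVec-injective {n} c d e k =
  trans (coefAt-toℕ c k) (trans (same (toℕ k) (FP.toℕ<n k)) (sym (coefAt-toℕ d k)))
  where
  same : ∀ m → m < n → coefAt c m ≡ coefAt d m
  same m p with weight-pos n m
  ... | w , ew = NP.*-cancelʳ-≡ (coefAt c m) (coefAt d m) (suc w) (ZP.+-injective (begin
      + (coefAt c m ℕ.* suc w)   ≡⟨ ZP.pos-* (coefAt c m) (suc w) ⟩
      + coefAt c m * + suc w     ≡⟨ cong (+ coefAt c m *_) (sym ew) ⟩
      + coefAt c m * weight n m  ≡⟨ sym (S-coefCoord n (coefAt c) m p) ⟩
      S (coords c) (suc m)       ≡⟨ S-Coords (toVec c) (coords c) (coords d) (toVec-coords c)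
                                      (Coords-≗ (toVec c) (toVec d) (coords d) e (toVec-coords d)) (suc m) p ⟩
      S (coords d) (suc m)       ≡⟨ S-coefCoord n (coefAt d) m p ⟩
      + coefAt d m * weight n m  ≡⟨ cong (+ coefAt d m *_) ew ⟩
      + coefAt d m * + suc w     ≡⟨ sym (ZP.pos-* (coefAt d m) (suc w)) ⟩
      + (coefAt d m ℕ.* suc w)   ∎))

δ : ℕ → ℕ → ℕ
δ zero zero = 1
δ zero (suc m) = 0
δ (suc a) zero = 0
δ (suc a) (suc m) = δ a m

E-δ : ∀ a m → E a m ≡ + δ a m
E-δ zero zero = rfl
E-δ zero (suc m) = rfl
E-δ (suc a) zero = rfl
E-δ (suc a) (suc m) = E-δ a m

δ-same : ∀ a → δ a a ≡ 1
δ-same zero = rfl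
δ-same (suc a) = δ-same a

δ-diff : ∀ a m → m ≢ a → δ a m ≡ 0
δ-diff zero zero ne = ⊥-elim (ne rfl)
δ-diff zero (suc m) ne = rfl
δ-diff (suc a) zero ne = rfl
δ-diff (suc a) (suc m) ne = δ-diff a m (λ e → ne (cong suc e))

HasCoef : ∀ {n} → Coef n → (ℕ → ℕ) → Set
HasCoef {n} c C = ∀ (k : Fin n) → c k ≡ C (toℕ k)

αℕ : ℕ → ℕ → ℕ → ℕ
αℕ n t m with suc m <? n | suc m ℕ.≟ t
... | yes _ | yes _ = 1
... | _     | _     = 0

α̂-coef : ∀ {n} t → HasCoef {n} (α̂ t) (αℕ n t)
α̂-coef {n} t k with suc (toℕ k) <? n | suc (toℕ k) ℕ.≟ t
... | yes _ | yes _ = rfl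
... | yes _ | no _ = rfl
... | no _ | yes _ = rfl
... | no _ | no _ = rfl

αℕ-δ : ∀ n t m → suc t < n → αℕ n (suc t) m ≡ δ t m
αℕ-δ n t m p with suc m <? n | suc m ℕ.≟ suc t
... | yes _ | yes e rewrite NP.suc-injective e = sym (δ-same t)
... | no q | yes e rewrite NP.suc-injective e = ⊥-elim (q p)
... | yes _ | no q = sym (δ-diff t m (λ e → q (cong suc e)))
... | no _ | no q = sym (δ-diff t m (λ e → q (cong suc e)))

βℕ : ℕ → ℕ → ℕ
βℕ n m with suc m ℕ.≟ n
... | yes _ = 1
... | no _ = 0

β̂-coef : ∀ {n} → HasCoef {n} β̂ (βℕ n)
β̂-coef {n} k with suc (toℕ k) ℕ.≟ n
... | yes _ = rfl
... | no _ = rfl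

βℕ-δ : ∀ n m → βℕ (suc n) m ≡ δ n m
βℕ-δ n m with suc m ℕ.≟ suc n
... | yes e rewrite NP.suc-injective e = sym (δ-same n)
... | no q = sym (δ-diff n m (λ e → q (cong suc e)))

coefCoord-+ : ∀ n C D m → coefCoord n (λ k → C k ℕ.+ D k) m ≡ coefCoord n C m + coefCoord n D m
coefCoord-+ n C D zero rewrite ZP.pos-+ (C 0) (D 0) = ring (+ C 0) (+ D 0) (weight n 0)
  where ring : ∀ a b w → (a + b) * w - + 0 ≡ (a * w - + 0) + (b * w - + 0)
        ring = solve-∀
coefCoord-+ n C D (suc m) rewrite ZP.pos-+ (C (suc m)) (D (suc m)) | ZP.pos-+ (C m) (D m) =
  ring (+ C (suc m)) (+ D (suc m)) (weight n (suc m)) (+ C m) (+ D m)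
  where ring : ∀ a b w c d → (a + b) * w - (c + d) ≡ (a * w - c) + (b * w - d)
        ring = solve-∀

coefCoord-* : ∀ n a C m → coefCoord n (λ k → a ℕ.* C k) m ≡ + a * coefCoord n C m
coefCoord-* n a C zero =
  trans (cong (λ z → z * weight n 0 - + 0) (ZP.pos-* a (C 0))) (ring (+ a) (+ C 0) (weight n 0))
  where ring : ∀ a c w → (a * c) * w - + 0 ≡ a * (c * w - + 0)
        ring = solve-∀
coefCoord-* n a C (suc m) =
  trans (cong₂ (λ z y → z * weight n (suc m) - y) (ZP.pos-* a (C (suc m))) (ZP.pos-* a (C m)))
        (ring (+ a) (+ C (suc m)) (weight n (suc m)) (+ C m))
  where ring : ∀ a c w d → (a * c) * w - (a * d) ≡ a * (c * w - d)
        ring = solve-∀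

coefCoord-0 : ∀ n m → coefCoord n (λ _ → 0) m ≡ + 0
coefCoord-0 n zero = ZP.*-zeroˡ (weight n 0)
coefCoord-0 n (suc m) = ZP.+-identityʳ (+ 0 * weight n (suc m))

coefCoord-α : ∀ n t m → suc t < n → coefCoord n (αℕ n (suc t)) m ≡ E t m - E (suc t) m
coefCoord-α n t m p =
  trans (cong₂ _-_ (cong (λ z → + z * weight n m) (αℕ-δ n t m p)) (previous m)) (cong (_- E (suc t) m) (current m))
  where
  previous : ∀ m → prevCoef (αℕ n (suc t)) m ≡ E (suc t) m
  previous zero = rfl
  previous (suc m) = trans (cong +_ (αℕ-δ n t m p)) (sym (E-δ t m))
  current : ∀ m → + δ t m * weight n m ≡ E t m
  current m with m ℕ.≟ t
  ... | yes rfl rewrite δ-same m | weight-α n m p | E-same m = rfl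
  ... | no q rewrite δ-diff t m q | E-diff t m q = ZP.*-zeroˡ (weight n m)

coefCoord-β : ∀ n m → m < suc n → coefCoord (suc n) (βℕ (suc n)) m ≡ + 2 * E n m
coefCoord-β n m p =
  trans (cong₂ _-_ (cong (λ z → + z * weight (suc n) m) (βℕ-δ n m)) (previous m p)) (current m)
  where
  previous : ∀ m → m < suc n → prevCoef (βℕ (suc n)) m ≡ + 0
  previous zero _ = rfl
  previous (suc m) p = cong +_ (trans (βℕ-δ n m) (δ-diff n m (λ e → NP.<-irrefl (cong suc e) p)))
  current : ∀ m → + δ n m * weight (suc n) m - + 0 ≡ + 2 * E n m
  current m with m ℕ.≟ n
  ... | yes rfl rewrite δ-same m | weight-β (suc m) m (NP.<-irrefl rfl) | E-same m = rfl
  ... | no q rewrite δ-diff n m q | E-diff n m q =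
    trans (ZP.+-identityʳ (+ 0 * weight (suc n) m)) (ZP.*-zeroˡ (weight (suc n) m))

sumαCoef : ℕ → List ℕ → ℕ → ℕ
sumαCoef n ts = foldr (λ t acc m → αℕ n t m ℕ.+ acc m) (λ _ → 0) ts

HasCoef-fold : ∀ {n} (ts : List ℕ) → HasCoef {n} (foldr (λ t acc → α̂ t +ᶜ acc) 0ᶜ ts) (sumαCoef n ts)
HasCoef-fold [] k = rfl
HasCoef-fold (t ∷ ts) k = cong₂ ℕ._+_ (α̂-coef t k) (HasCoef-fold ts k)

sumαIndices : ℕ → ℕ → List ℕ
sumαIndices a b = applyUpTo (a ℕ.+_) (b ∸ a)

HasCoef-sumα : ∀ {n} a b → HasCoef {n} (sumα a b) (sumαCoef n (sumαIndices a b))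
HasCoef-sumα a b = HasCoef-fold (sumαIndices a b)

coefCoord-telescope : ∀ n L b (f : ℕ → ℕ) → (∀ k → f k ≡ suc (b ℕ.+ k)) → b ℕ.+ L < n → ∀ m →
                      coefCoord n (sumαCoef n (applyUpTo f L)) m ≡ E b m - E (b ℕ.+ L) m
coefCoord-telescope n zero b f hf bn m rewrite NP.+-identityʳ b =
  trans (coefCoord-0 n m) (sym (ZP.+-inverseʳ (E b m)))
coefCoord-telescope n (suc L) b f hf bn m = begin
    coefCoord n (sumαCoef n (applyUpTo f (suc L))) m
      ≡⟨ coefCoord-+ n (αℕ n (f 0)) (sumαCoef n (applyUpTo (λ k → f (suc k)) L)) m ⟩
    coefCoord n (αℕ n (f 0)) m + coefCoord n (sumαCoef n (applyUpTo (λ k → f (suc k)) L)) m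
      ≡⟨ cong₂ _+_ (trans (cong (λ t → coefCoord n (αℕ n t) m) f0) (coefCoord-α n b m sb)) rest ⟩
    (E b m - E (suc b) m) + (E (suc b) m - E (suc b ℕ.+ L) m)
      ≡⟨ telescope (E b m) (E (suc b) m) (E (suc b ℕ.+ L) m) ⟩
    E b m - E (suc b ℕ.+ L) m
      ≡⟨ cong (λ z → E b m - E z m) (sym (NP.+-suc b L)) ⟩
    E b m - E (b ℕ.+ suc L) m ∎
  where
  f0 : f 0 ≡ suc b
  f0 = trans (hf 0) (cong suc (NP.+-identityʳ b))
  sb : suc b < n
  sb = NP.≤-<-trans (subst (suc b ≤_) (sym (NP.+-suc b L)) (s≤s (NP.m≤m+n b L))) bn
  rest = coefCoord-telescope n L (suc b) (λ k → f (suc k))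
           (λ k → trans (hf (suc k)) (cong suc (NP.+-suc b k))) (subst (_< n) (NP.+-suc b L) bn) m
  telescope : ∀ a b c → (a - b) + (b - c) ≡ a - c
  telescope = solve-∀

coefCoord-sumα : ∀ n' c q → c ≤ q → q ≤ n' → ∀ m →
                 coefCoord (suc n') (sumαCoef (suc n') (sumαIndices (suc c) (suc q))) m ≡ E c m - E q m
coefCoord-sumα n' c q cq qn m =
  trans (coefCoord-telescope (suc n') (q ∸ c) c (suc c ℕ.+_) (λ k → rfl)
          (subst (_< suc n') (sym (NP.m+[n∸m]≡n cq)) (s≤s qn)) m)
        (cong (λ z → E c m - E z m) (NP.m+[n∸m]≡n cq))

sumα-coords : ∀ n' c q → c ≤ q → q ≤ n' →
              Coords (toVec (sumα {suc n'} (suc c) (suc q))) (λ m → E c m - E q m)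
sumα-coords n' c q cq qn =
  Coords-ext (toVec (sumα {suc n'} (suc c) (suc q))) (coefCoord (suc n') A) (λ m → E c m - E q m)
    (coefCoord-sumα n' c q cq qn) (toVec-coefCoord (sumα {suc n'} (suc c) (suc q)) A (HasCoef-sumα (suc c) (suc q)))
  where A = sumαCoef (suc n') (sumαIndices (suc c) (suc q))

γCoef : ℕ → ℕ → ℕ → ℕ → ℕ
γCoef n i p m = (sumαCoef n (sumαIndices i p) m ℕ.+ 2 ℕ.* sumαCoef n (sumαIndices p n) m) ℕ.+ βℕ n m

HasCoef-γ : ∀ {n} i p → HasCoef {n} (γ[_,_] {n} i p) (γCoef n i p)
HasCoef-γ i p k =
  cong₂ ℕ._+_ (cong₂ ℕ._+_ (HasCoef-sumα i p k) (cong (2 ℕ.*_) (HasCoef-sumα p _ k))) (β̂-coef k)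

γ-coords : ∀ n' c q → c ≤ q → q ≤ n' →
           Coords (toVec (γ[_,_] {suc n'} (suc c) (suc q))) (λ m → E c m + E q m)
γ-coords n' c q cq qn =
  Coords-ext< (toVec (γ[_,_] {suc n'} (suc c) (suc q))) (coefCoord N (γCoef N (suc c) (suc q))) _ coordinate
    (toVec-coefCoord (γ[_,_] {suc n'} (suc c) (suc q)) (γCoef N (suc c) (suc q)) (HasCoef-γ (suc c) (suc q)))
  where
  N = suc n'
  A = sumαCoef N (sumαIndices (suc c) (suc q))
  B = sumαCoef N (sumαIndices (suc q) N)
  regroup : ∀ a b c → ((a - b) + + 2 * (b - c)) + + 2 * c ≡ a + b
  regroup = solve-∀
  coordinate : ∀ m → m < N → coefCoord N (γCoef N (suc c) (suc q)) m ≡ E c m + E q m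
  coordinate m p = begin
      coefCoord N (γCoef N (suc c) (suc q)) m
        ≡⟨ coefCoord-+ N (λ k → A k ℕ.+ 2 ℕ.* B k) (βℕ N) m ⟩
      coefCoord N (λ k → A k ℕ.+ 2 ℕ.* B k) m + coefCoord N (βℕ N) m
        ≡⟨ cong (_+ coefCoord N (βℕ N) m) (coefCoord-+ N A (λ k → 2 ℕ.* B k) m) ⟩
      (coefCoord N A m + coefCoord N (λ k → 2 ℕ.* B k) m) + coefCoord N (βℕ N) m
        ≡⟨ cong₂ _+_ (cong₂ _+_ (coefCoord-sumα n' c q cq qn m)
                                (trans (coefCoord-* N 2 B m) (cong (+ 2 *_) (coefCoord-sumα n' q n' qn NP.≤-refl m))))
                     (coefCoord-β n' m p) ⟩
      ((E c m - E q m) + + 2 * (E q m - E n' m)) + + 2 * E n' m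
        ≡⟨ regroup (E c m) (E q m) (E n' m) ⟩
      E c m + E q m ∎

γ₂Coef : ℕ → ℕ → ℕ → ℕ
γ₂Coef n i m = 2 ℕ.* sumαCoef n (sumαIndices i n) m ℕ.+ βℕ n m

HasCoef-γ₂ : ∀ {n} i → HasCoef {n} (γ₂ {n} i) (γ₂Coef n i)
HasCoef-γ₂ i k = cong₂ ℕ._+_ (cong (2 ℕ.*_) (HasCoef-sumα i _ k)) (β̂-coef k)

γ₂-coords : ∀ n' c → c ≤ n' → Coords (toVec (γ₂ {suc n'} (suc c))) (λ m → + 2 * E c m)
γ₂-coords n' c cn =
  Coords-ext< (toVec (γ₂ {suc n'} (suc c))) (coefCoord N (γ₂Coef N (suc c))) _ coordinate
    (toVec-coefCoord (γ₂ {suc n'} (suc c)) (γ₂Coef N (suc c)) (HasCoef-γ₂ (suc c)))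
  where
  N = suc n'
  B = sumαCoef N (sumαIndices (suc c) N)
  regroup : ∀ a c → + 2 * (a - c) + + 2 * c ≡ + 2 * a
  regroup = solve-∀
  coordinate : ∀ m → m < N → coefCoord N (γ₂Coef N (suc c)) m ≡ + 2 * E c m
  coordinate m p = begin
      coefCoord N (γ₂Coef N (suc c)) m
        ≡⟨ coefCoord-+ N (λ k → 2 ℕ.* B k) (βℕ N) m ⟩
      coefCoord N (λ k → 2 ℕ.* B k) m + coefCoord N (βℕ N) m
        ≡⟨ cong₂ _+_ (trans (coefCoord-* N 2 B m) (cong (+ 2 *_) (coefCoord-sumα n' c n' cn NP.≤-refl m)))
                     (coefCoord-β n' m p) ⟩
      + 2 * (E c m - E n' m) + + 2 * E n' m
        ≡⟨ regroup (E c m) (E n' m) ⟩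
      + 2 * E c m ∎

sumCoef : ℕ → (ℕ → ℕ) → ℕ
sumCoef zero C = 0
sumCoef (suc n) C = C 0 ℕ.+ sumCoef n (λ m → C (suc m))

ht-HasCoef : ∀ {n} (c : Coef n) C → HasCoef c C → ht c ≡ sumCoef n C
ht-HasCoef {zero} c C h = rfl
ht-HasCoef {suc n} c C h =
  cong₂ ℕ._+_ (h F.zero) (ht-HasCoef {n} (λ k → c (F.suc k)) (λ m → C (suc m)) (λ k → h (F.suc k)))

ht-cong : ∀ {n} (c d : Coef n) → (∀ k → c k ≡ d k) → ht c ≡ ht d
ht-cong {zero} c d e = rfl
ht-cong {suc n} c d e =
  cong₂ ℕ._+_ (e F.zero) (ht-cong {n} (λ k → c (F.suc k)) (λ k → d (F.suc k)) (λ k → e (F.suc k)))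

sumCoef-cong : ∀ n C D → (∀ m → C m ≡ D m) → sumCoef n C ≡ sumCoef n D
sumCoef-cong zero C D e = rfl
sumCoef-cong (suc n) C D e = cong₂ ℕ._+_ (e 0) (sumCoef-cong n _ _ (λ m → e (suc m)))

sumCoef-+ : ∀ n C D → sumCoef n (λ m → C m ℕ.+ D m) ≡ sumCoef n C ℕ.+ sumCoef n D
sumCoef-+ zero C D = rfl
sumCoef-+ (suc n) C D rewrite sumCoef-+ n (λ m → C (suc m)) (λ m → D (suc m)) =
  interchange (C 0) (D 0) (sumCoef n (λ m → C (suc m))) (sumCoef n (λ m → D (suc m)))
  where
  interchange : ∀ a b c d → a ℕ.+ b ℕ.+ (c ℕ.+ d) ≡ a ℕ.+ c ℕ.+ (b ℕ.+ d)
  interchange = solveℕ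

sumCoef-* : ∀ n a C → sumCoef n (λ m → a ℕ.* C m) ≡ a ℕ.* sumCoef n C
sumCoef-* zero a C = sym (NP.*-zeroʳ a)
sumCoef-* (suc n) a C rewrite sumCoef-* n a (λ m → C (suc m)) = sym (NP.*-distribˡ-+ a (C 0) _)

sumCoef-0 : ∀ n → sumCoef n (λ _ → 0) ≡ 0
sumCoef-0 zero = rfl
sumCoef-0 (suc n) = sumCoef-0 n

sumCoef-δ : ∀ n a → a < n → sumCoef n (δ a) ≡ 1
sumCoef-δ (suc n) zero p = cong suc (sumCoef-0 n)
sumCoef-δ (suc n) (suc a) (s≤s p) = sumCoef-δ n a p

sumCoef-sumα : ∀ n L b (f : ℕ → ℕ) → (∀ k → f k ≡ suc (b ℕ.+ k)) → b ℕ.+ L < n →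
               sumCoef n (sumαCoef n (applyUpTo f L)) ≡ L
sumCoef-sumα n zero b f hf bn = sumCoef-0 n
sumCoef-sumα n (suc L) b f hf bn =
  trans (sumCoef-+ n (αℕ n (f 0)) _) (cong₂ ℕ._+_ first rest)
  where
  f0 : f 0 ≡ suc b
  f0 = trans (hf 0) (cong suc (NP.+-identityʳ b))
  sb : suc b < n
  sb = NP.≤-<-trans (subst (suc b ≤_) (sym (NP.+-suc b L)) (s≤s (NP.m≤m+n b L))) bn
  first : sumCoef n (αℕ n (f 0)) ≡ 1
  first = trans (sumCoef-cong n _ _ (λ m → trans (cong (λ t → αℕ n t m) f0) (αℕ-δ n b m sb)))
                (sumCoef-δ n b (NP.<-trans (NP.n<1+n b) sb))
  rest : sumCoef n (sumαCoef n (applyUpTo (λ k → f (suc k)) L)) ≡ L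
  rest = sumCoef-sumα n L (suc b) (λ k → f (suc k)) (λ k → trans (hf (suc k)) (cong suc (NP.+-suc b k)))
           (subst (_< n) (NP.+-suc b L) bn)

sumCoef-sumα′ : ∀ n' c q → c ≤ q → q ≤ n' →
                sumCoef (suc n') (sumαCoef (suc n') (sumαIndices (suc c) (suc q))) ≡ q ∸ c
sumCoef-sumα′ n' c q cq qn =
  sumCoef-sumα (suc n') (q ∸ c) c (suc c ℕ.+_) (λ k → rfl)
    (subst (_< suc n') (sym (NP.m+[n∸m]≡n cq)) (s≤s qn))

sumCoef-β : ∀ n' → sumCoef (suc n') (βℕ (suc n')) ≡ 1
sumCoef-β n' = trans (sumCoef-cong (suc n') (βℕ (suc n')) (δ n') (βℕ-δ n')) (sumCoef-δ (suc n') n' NP.≤-refl)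

ht-sumα : ∀ n' c q → c ≤ q → q ≤ n' → ht (sumα {suc n'} (suc c) (suc q)) ≡ q ∸ c
ht-sumα n' c q cq qn =
  trans (ht-HasCoef (sumα {suc n'} (suc c) (suc q)) (sumαCoef (suc n') (sumαIndices (suc c) (suc q)))
                    (HasCoef-sumα (suc c) (suc q))) (sumCoef-sumα′ n' c q cq qn)

ht-γ : ∀ n' c q → c ≤ q → q ≤ n' →
       ht (γ[_,_] {suc n'} (suc c) (suc q)) ≡ (q ∸ c) ℕ.+ 2 ℕ.* (n' ∸ q) ℕ.+ 1
ht-γ n' c q cq qn = begin
    ht (γ[_,_] {N} (suc c) (suc q))
      ≡⟨ ht-HasCoef (γ[_,_] {N} (suc c) (suc q)) (γCoef N (suc c) (suc q)) (HasCoef-γ (suc c) (suc q)) ⟩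
    sumCoef N (γCoef N (suc c) (suc q))
      ≡⟨ sumCoef-+ N (λ k → A k ℕ.+ 2 ℕ.* B k) (βℕ N) ⟩
    sumCoef N (λ k → A k ℕ.+ 2 ℕ.* B k) ℕ.+ sumCoef N (βℕ N)
      ≡⟨ cong (ℕ._+ sumCoef N (βℕ N)) (sumCoef-+ N A (λ k → 2 ℕ.* B k)) ⟩
    sumCoef N A ℕ.+ sumCoef N (λ k → 2 ℕ.* B k) ℕ.+ sumCoef N (βℕ N)
      ≡⟨ cong₂ ℕ._+_ (cong₂ ℕ._+_ (sumCoef-sumα′ n' c q cq qn)
                                  (trans (sumCoef-* N 2 B) (cong (2 ℕ.*_) (sumCoef-sumα′ n' q n' qn NP.≤-refl))))
                     (sumCoef-β n') ⟩
    (q ∸ c) ℕ.+ 2 ℕ.* (n' ∸ q) ℕ.+ 1 ∎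
  where
  N = suc n'
  A = sumαCoef N (sumαIndices (suc c) (suc q))
  B = sumαCoef N (sumαIndices (suc q) N)

shift₁ : ∀ c A D → suc (c ℕ.+ A ℕ.+ D) ∸ c ≡ suc (A ℕ.+ D)
shift₁ c A D = trans (cong (_∸ c) (assoc c A D)) (NP.m+n∸m≡n c (suc (A ℕ.+ D)))
  where assoc : ∀ c a d → suc (c ℕ.+ a ℕ.+ d) ≡ c ℕ.+ suc (a ℕ.+ d)
        assoc = solveℕ

shift₂ : ∀ c A D B → suc (c ℕ.+ A ℕ.+ D) ℕ.+ B ∸ (c ℕ.+ A) ≡ suc (D ℕ.+ B)
shift₂ c A D B = trans (cong (_∸ (c ℕ.+ A)) (assoc c A D B)) (NP.m+n∸m≡n (c ℕ.+ A) (suc (D ℕ.+ B)))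
  where assoc : ∀ c a d b → suc (c ℕ.+ a ℕ.+ d) ℕ.+ b ≡ c ℕ.+ a ℕ.+ suc (d ℕ.+ b)
        assoc = solveℕ

ht-γ-anti : ∀ c x y n' → c ≤ x → x < y → y ≤ n' →
            (y ∸ c) ℕ.+ 2 ℕ.* (n' ∸ y) ℕ.+ 1 < (x ∸ c) ℕ.+ 2 ℕ.* (n' ∸ x) ℕ.+ 1
ht-γ-anti c x y n' cx xy yn with NP.m≤n⇒∃[o]m+o≡n cx
... | A , rfl with NP.m≤n⇒∃[o]m+o≡n xy
... | D , rfl with NP.m≤n⇒∃[o]m+o≡n yn
... | B , rfl rewrite shift₁ c A D | NP.m+n∸m≡n (suc (c ℕ.+ A ℕ.+ D)) B | NP.m+n∸m≡n c A | shift₂ c A D B =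
  subst (suc (suc (A ℕ.+ D) ℕ.+ 2 ℕ.* B ℕ.+ 1) ≤_) (sym (expand A D B)) (NP.m≤m+n _ D)
  where
  expand : ∀ a d b → a ℕ.+ 2 ℕ.* suc (d ℕ.+ b) ℕ.+ 1 ≡ suc (suc (a ℕ.+ d) ℕ.+ 2 ℕ.* b ℕ.+ 1) ℕ.+ d
  expand = solveℕ

ht-sumα<ht-γ : ∀ c d x n' → c ≤ d → d ≤ n' → c ≤ x → x ≤ n' →
               d ∸ c < (x ∸ c) ℕ.+ 2 ℕ.* (n' ∸ x) ℕ.+ 1
ht-sumα<ht-γ c d x n' cd dn cx xn with NP.m≤n⇒∃[o]m+o≡n cx
... | A , rfl with NP.m≤n⇒∃[o]m+o≡n xn
... | B , rfl rewrite NP.m+n∸m≡n c A | NP.m+n∸m≡n (c ℕ.+ A) B =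
  subst (suc (d ∸ c) ≤_) (sym (NP.+-comm (A ℕ.+ 2 ℕ.* B) 1)) (s≤s d∸c≤A+2B)
  where
  top : c ℕ.+ A ℕ.+ B ∸ c ≡ A ℕ.+ B
  top = trans (cong (_∸ c) (NP.+-assoc c A B)) (NP.m+n∸m≡n c (A ℕ.+ B))
  twice : ∀ a b → a ℕ.+ 2 ℕ.* b ≡ a ℕ.+ b ℕ.+ b
  twice = solveℕ
  d∸c≤A+2B : d ∸ c ≤ A ℕ.+ 2 ℕ.* B
  d∸c≤A+2B = NP.≤-trans (NP.∸-monoˡ-≤ c dn)
               (NP.≤-trans (NP.≤-reflexive top)
                 (NP.≤-trans (NP.m≤m+n (A ℕ.+ B) B) (NP.≤-reflexive (sym (twice A B)))))

shortRoot : ℤ → ℕ → ℤ → ℕ → ℕ → ℤ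
shortRoot s a t b m = s * E a m + t * E b m

longRoot : ℤ → ℕ → ℕ → ℤ
longRoot s a m = (+ 2 * s) * E a m

shortRoot-isRoot : ∀ {n} (v : Vec n) (a b : Fin n) s t → a ≢ b → IsSign s → IsSign t →
                   Coords v (shortRoot s (toℕ a) t (toℕ b)) → IsRoot v
shortRoot-isRoot v a b s t ab ss st r =
  inj₁ (a , b , s , t , ab , ss , st ,
        λ l → trans (r l) (sym (cong₂ (λ u w → s * u + t * w) (eℕ-E (toℕ a) l) (eℕ-E (toℕ b) l))))

longRoot-isRoot : ∀ {n} (v : Vec n) (a : Fin n) s → IsSign s → Coords v (longRoot s (toℕ a)) → IsRoot v
longRoot-isRoot v a s ss r = inj₂ (a , s , ss , λ l → trans (r l) (sym (cong ((+ 2 * s) *_) (eℕ-E (toℕ a) l))))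

shortRoot-coords : ∀ {n} (v : Vec n) (a b : Fin n) s t →
                   v ≗ᵥ ((s ·ᵥ eℕ (toℕ a)) +ᵥ (t ·ᵥ eℕ (toℕ b))) →
                   Coords v (shortRoot s (toℕ a) t (toℕ b))
shortRoot-coords v a b s t e l = trans (e l) (cong₂ (λ u w → s * u + t * w) (eℕ-E (toℕ a) l) (eℕ-E (toℕ b) l))

longRoot-coords : ∀ {n} (v : Vec n) (a : Fin n) s → v ≗ᵥ ((+ 2 * s) ·ᵥ eℕ (toℕ a)) →
                  Coords v (longRoot s (toℕ a))
longRoot-coords v a s e l = trans (e l) (cong ((+ 2 * s) *_) (eℕ-E (toℕ a) l))

swapFin : ∀ {n} k → suc k < n → Fin n → Fin n
swapFin {n} k p a = fromℕ< (swap-bound k (toℕ a) n p (FP.toℕ<n a))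

swapFin-toℕ : ∀ {n} k (p : suc k < n) a → toℕ (swapFin k p a) ≡ swap k (toℕ a)
swapFin-toℕ k p a = FP.toℕ-fromℕ< _

swapFin-injective : ∀ {n} k (p : suc k < n) a b → a ≢ b → swapFin k p a ≢ swapFin k p b
swapFin-injective k p a b ab e = ab (FP.toℕ-injective (begin
    toℕ a                         ≡⟨ sym (swap-invol k (toℕ a)) ⟩
    swap k (swap k (toℕ a))       ≡⟨ cong (swap k) (sym (swapFin-toℕ k p a)) ⟩
    swap k (toℕ (swapFin k p a))  ≡⟨ cong (λ z → swap k (toℕ z)) e ⟩
    swap k (toℕ (swapFin k p b))  ≡⟨ cong (swap k) (swapFin-toℕ k p b) ⟩
    swap k (swap k (toℕ b))       ≡⟨ swap-invol k (toℕ b) ⟩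
    toℕ b                         ∎))

E-swapFin : ∀ {n} k (p : suc k < n) (a : Fin n) m → E (toℕ a) (swap k m) ≡ E (toℕ (swapFin k p a)) m
E-swapFin k p a m = trans (E-swap k (toℕ a) m) (cong (λ z → E z m) (sym (swapFin-toℕ k p a)))

-- The reflection in α permutes the support of a root, keeping its signs.
reflα-root : ∀ {n} (g : Fin n) (v : Vec n) → suc (toℕ g) < n → IsRoot v → IsRoot (refl (simpleRoot g) v)
reflα-root g v p (inj₁ (a , b , s , t , ab , ss , st , e)) =
  shortRoot-isRoot _ (swapFin k p a) (swapFin k p b) s t (swapFin-injective k p a b ab) ss st
    (Coords-ext _ _ _ (λ m → cong₂ (λ u w → s * u + t * w) (E-swapFin k p a m) (E-swapFin k p b m))
      (reflα g v (shortRoot s (toℕ a) t (toℕ b)) p (shortRoot-coords v a b s t e)))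
  where k = toℕ g
reflα-root g v p (inj₂ (a , s , ss , e)) =
  longRoot-isRoot _ (swapFin k p a) s ss
    (Coords-ext _ _ _ (λ m → cong ((+ 2 * s) *_) (E-swapFin k p a m))
      (reflα g v (longRoot s (toℕ a)) p (longRoot-coords v a s e)))
  where k = toℕ g

-- flip g a s is the new coefficient of e_a once the entry g is negated.
flip : ℕ → ℕ → ℤ → ℤ
flip g a s with a ℕ.≟ g
... | yes _ = - s
... | no _ = s

flip-sign : ∀ g a {s} → IsSign s → IsSign (flip g a s)
flip-sign g a ss with a ℕ.≟ g
flip-sign g a (inj₁ rfl) | yes _ = inj₂ rfl
flip-sign g a (inj₂ rfl) | yes _ = inj₁ rfl
... | no _ = ss

flip-double : ∀ g a s → flip g a (+ 2 * s) ≡ + 2 * flip g a s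
flip-double g a s with a ℕ.≟ g
... | yes _ = ZP.neg-distribʳ-* (+ 2) s
... | no _ = rfl

negEntry-unit : ∀ g a s m → negEntry g (λ k → s * E a k) m ≡ flip g a s * E a m
negEntry-unit g a s m with a ℕ.≟ g
... | yes rfl rewrite E-same a = ring s (E a m)
  where ring : ∀ s e → s * e - (+ 2 * (s * + 1)) * e ≡ - s * e
        ring = solve-∀
... | no q rewrite E-diff a g (λ e → q (sym e)) = ring s (E a m) (E g m)
  where ring : ∀ s e f → s * e - (+ 2 * (s * + 0)) * f ≡ s * e
        ring = solve-∀

negEntry-+ : ∀ g F G m → negEntry g (λ k → F k + G k) m ≡ negEntry g F m + negEntry g G m
negEntry-+ g F G m = ring (F m) (G m) (F g) (G g) (E g m)
  where ring : ∀ a b c d e → a + b - (+ 2 * (c + d)) * e ≡ (a - (+ 2 * c) * e) + (b - (+ 2 * d) * e)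
        ring = solve-∀

negEntry-short : ∀ g s a t b m →
  negEntry g (shortRoot s a t b) m ≡ shortRoot (flip g a s) a (flip g b t) b m
negEntry-short g s a t b m =
  trans (negEntry-+ g (λ k → s * E a k) (λ k → t * E b k) m)
        (cong₂ _+_ (negEntry-unit g a s m) (negEntry-unit g b t m))

negEntry-long : ∀ g s a m → negEntry g (longRoot s a) m ≡ longRoot (flip g a s) a m
negEntry-long g s a m =
  trans (negEntry-unit g a (+ 2 * s) m) (cong (_* E a m) (flip-double g a s))

-- The reflection in β flips signs on the support of a root.
reflβ-root : ∀ {n} (g : Fin n) (v : Vec n) → ¬ (suc (toℕ g) < n) → IsRoot v → IsRoot (refl (simpleRoot g) v)
reflβ-root g v p (inj₁ (a , b , s , t , ab , ss , st , e)) =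
  shortRoot-isRoot _ a b (flip k (toℕ a) s) (flip k (toℕ b) t) ab (flip-sign k (toℕ a) ss) (flip-sign k (toℕ b) st)
    (Coords-ext _ _ _ (negEntry-short k s (toℕ a) t (toℕ b))
      (reflLong k (simpleRoot g) v (shortRoot s (toℕ a) t (toℕ b)) (FP.toℕ<n g) (simpleRoot-β g p)
                (shortRoot-coords v a b s t e)))
  where k = toℕ g
reflβ-root g v p (inj₂ (a , s , ss , e)) =
  longRoot-isRoot _ a (flip k (toℕ a) s) (flip-sign k (toℕ a) ss)
    (Coords-ext _ _ _ (negEntry-long k s (toℕ a))
      (reflLong k (simpleRoot g) v (longRoot s (toℕ a)) (FP.toℕ<n g) (simpleRoot-β g p) (longRoot-coords v a s e)))
  where k = toℕ g

simpleRefl-root : ∀ {n} (g : Fin n) (v : Vec n) → IsRoot v → IsRoot (refl (simpleRoot g) v)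
simpleRefl-root {n} g v r = byKind (suc (toℕ g) <? n)
  where
  byKind : Dec (suc (toℕ g) < n) → IsRoot (refl (simpleRoot g) v)
  byKind (yes p) = reflα-root g v p r
  byKind (no p) = reflβ-root g v p r

act-root : ∀ {n} (w : Word n) (v : Vec n) → IsRoot v → IsRoot (act w v)
act-root [] v r = r
act-root (g ∷ w) v r = simpleRefl-root g (act w v) (act-root w v r)

S-+ : ∀ (F G : ℕ → ℤ) m → S (λ k → F k + G k) m ≡ S F m + S G m
S-+ F G zero = rfl
S-+ F G (suc m) rewrite S-+ F G m = interchange (S F m) (S G m) (F m) (G m)
  where interchange : ∀ a b c d → a + b + (c + d) ≡ a + c + (b + d)
        interchange = solve-∀

S-* : ∀ (u : ℤ) (F : ℕ → ℤ) m → S (λ k → u * F k) m ≡ u * S F m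
S-* u F zero = sym (ZP.*-zeroʳ u)
S-* u F (suc m) rewrite S-* u F m = sym (ZP.*-distribˡ-+ u (S F m) (F m))

S-E-≤ : ∀ a m → m ≤ a → S (E a) m ≡ + 0
S-E-≤ a zero p = rfl
S-E-≤ a (suc m) p rewrite S-E-≤ a m (NP.<⇒≤ p) | E-diff a m (λ e → NP.<-irrefl e p) = rfl

S-E-> : ∀ a m → a < m → S (E a) m ≡ + 1
S-E-> a (suc m) (s≤s p) with NP.m≤n⇒m<n∨m≡n p
... | inj₁ q rewrite S-E-> a m q | E-diff a m (λ e → NP.<-irrefl (sym e) q) = rfl
... | inj₂ rfl rewrite S-E-≤ a a NP.≤-refl | E-same a = rfl

S-sub-E : ∀ (F : ℕ → ℤ) u c m → S (λ k → F k - u * E c k) m ≡ S F m - u * S (E c) m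
S-sub-E F u c m = begin
    S (λ k → F k - u * E c k) m
      ≡⟨ S-+ F (λ k → - (u * E c k)) m ⟩
    S F m + S (λ k → - (u * E c k)) m
      ≡⟨ cong (λ z → S F m + z) (trans (S-cong _ (λ k → (- u) * E c k) m (λ k _ → ZP.neg-distribˡ-* u (E c k)))
                                (S-* (- u) (E c) m)) ⟩
    S F m + (- u) * S (E c) m
      ≡⟨ cong (λ z → S F m + z) (sym (ZP.neg-distribˡ-* u (S (E c) m))) ⟩
    S F m - u * S (E c) m ∎

S-sub-E-≤ : ∀ (F : ℕ → ℤ) u c m → m ≤ c → S (λ k → F k - u * E c k) m ≡ S F m
S-sub-E-≤ F u c m p rewrite S-sub-E F u c m | S-E-≤ c m p | ZP.*-zeroʳ u = ZP.+-identityʳ (S F m)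

S-sub-E-> : ∀ (F : ℕ → ℤ) u c m → c < m → S (λ k → F k - u * E c k) m ≡ S F m - u
S-sub-E-> F u c m p rewrite S-sub-E F u c m | S-E-> c m p | ZP.*-identityʳ u = rfl

S-shortRoot : ∀ s a t b m → S (shortRoot s a t b) m ≡ s * S (E a) m + t * S (E b) m
S-shortRoot s a t b m = trans (S-+ _ _ m) (cong₂ _+_ (S-* s (E a) m) (S-* t (E b) m))

pred-split : ∀ {x y} → suc x ≤ y → Σ ℕ λ k → (y ≡ suc k) × (x ≤ k)
pred-split (s≤s p) = _ , rfl , p

-- σ = s_{α_{b+1}} ⋯ s_{α_{n'}} s_β s_{α_{n'}} ⋯ s_{α_{c+1}} (i = c+1, j = b+2) in coordinates:
-- first the entry c is moved to the end, then negated, then moved to position b.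
σCoords : ℕ → ℕ → ℕ → (ℕ → ℤ) → ℕ → ℤ
σCoords n' b c F m = negEntry n' (λ k → F (cycleDesc c (n' ∸ c) k)) (cycleAsc b (n' ∸ b) m)

act-σ : ∀ n' b c → c ≤ b → b < n' → (x : Vec (suc n')) → ∀ F → Coords x F →
        Coords (act (σW {suc n'} (suc c) (suc (suc b))) x) (σCoords n' b c F)
act-σ n' b c cb bn x F r =
  subst (λ y → Coords y (σCoords n' b c F)) (sym unfold)
    (act-asc (n' ∸ b) b (suc b ℕ.+_) (λ k → rfl)
      (subst (_< suc n') (sym (NP.m+[n∸m]≡n (NP.<⇒≤ bn))) (NP.n<1+n n'))
      (act sβ (act desc x)) (negEntry n' G)
      (act-sβ n' (act desc x) G
        (act-desc (n' ∸ c) c (suc c ℕ.+_) (λ k → rfl) (subst (_< suc n') (sym (NP.m+[n∸m]≡n cn)) (NP.n<1+n n'))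
          x F r)))
  where
  asc desc : Word (suc n')
  asc = ascα (suc b) n'
  desc = descα n' (suc c)
  unfold : act (asc ++ (sβ ++ desc)) x ≡ act asc (act sβ (act desc x))
  unfold = trans (act-++ asc (sβ ++ desc) x) (cong (act asc) (act-++ sβ desc x))
  cn : c ≤ n'
  cn = NP.≤-trans cb (NP.<⇒≤ bn)
  G : ℕ → ℤ
  G k = F (cycleDesc c (n' ∸ c) k)

module σValues (n' b c : ℕ) (F : ℕ → ℤ) (cb : c ≤ b) (bn : b < n') where
  private
    Lc = n' ∸ c
    Lb = n' ∸ b
    eqc : c ℕ.+ Lc ≡ n'
    eqc = NP.m+[n∸m]≡n (NP.≤-trans cb (NP.<⇒≤ bn))
    eqb : b ℕ.+ Lb ≡ n'
    eqb = NP.m+[n∸m]≡n (NP.<⇒≤ bn)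
    G : ℕ → ℤ
    G k = F (cycleDesc c Lc k)
    untouched : ∀ k → k < n' → negEntry n' G k ≡ G k
    untouched k p rewrite E-diff n' k (λ e → NP.<-irrefl e p) | ZP.*-zeroʳ (+ 2 * G n') = ZP.+-identityʳ (G k)

  σ-below : ∀ m → m < c → σCoords n' b c F m ≡ F m
  σ-below m p rewrite cycleAsc-lt Lb b m (NP.<-≤-trans p cb) =
    trans (untouched m (NP.<-≤-trans p (NP.≤-trans cb (NP.<⇒≤ bn)))) (cong F (cycleDesc-lt Lc c m p))

  σ-shifted : ∀ m → c ≤ m → m < b → σCoords n' b c F m ≡ F (suc m)
  σ-shifted m p q rewrite cycleAsc-lt Lb b m q =
    trans (untouched m (NP.<-trans q bn)) (cong F (cycleDesc-mid Lc c m p (subst (m <_) (sym eqc) (NP.<-trans q bn))))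

  σ-at-b : σCoords n' b c F b ≡ - F c
  σ-at-b rewrite cycleAsc-start Lb b | eqb | E-same n' =
    trans (cong (λ z → F z - (+ 2 * F z) * + 1) (subst (λ w → cycleDesc c Lc w ≡ c) eqc (cycleDesc-end Lc c)))
          (ring (F c))
    where ring : ∀ a → a - (+ 2 * a) * + 1 ≡ - a
          ring = solve-∀

  σ-above : ∀ m → b ≤ m → m < n' → σCoords n' b c F (suc m) ≡ F (suc m)
  σ-above m p q rewrite cycleAsc-mid Lb b m p (subst (m <_) (sym eqb) q) =
    trans (untouched m q) (cong F (cycleDesc-mid Lc c m (NP.≤-trans cb p) (subst (m <_) (sym eqc) q)))

  S-σ-below : ∀ m → m ≤ c → S (σCoords n' b c F) m ≡ S F m
  S-σ-below zero p = rfl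
  S-σ-below (suc m) p = cong₂ _+_ (S-σ-below m (NP.<⇒≤ p)) (σ-below m p)

  S-σ-shifted : ∀ m → c ≤ m → m < b → S (σCoords n' b c F) (suc m) ≡ S F (suc (suc m)) - F c
  S-σ-shifted m p q with NP.m≤n⇒m<n∨m≡n p
  ... | inj₂ rfl rewrite S-σ-below m NP.≤-refl | σ-shifted m p q = ring (S F m) (F m) (F (suc m))
    where ring : ∀ a b c → a + c ≡ a + b + c - b
          ring = solve-∀
  ... | inj₁ cm with m
  ...   | suc m' rewrite S-σ-shifted m' (NP.≤-pred cm) (NP.<-trans (NP.n<1+n m') q) | σ-shifted (suc m') p q =
    ring (S F (suc (suc m'))) (F c) (F (suc (suc m')))
    where ring : ∀ a b c → a - b + c ≡ a + c - b
          ring = solve-∀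

  S-σ-above : ∀ m → b ≤ m → m ≤ n' → S (σCoords n' b c F) (suc m) ≡ S F (suc m) - + 2 * F c
  S-σ-above m p q with NP.m≤n⇒m<n∨m≡n p
  ... | inj₂ rfl rewrite σ-at-b = atB (NP.m≤n⇒m<n∨m≡n cb)
    where
    atB : (c < b) ⊎ (c ≡ b) → S (σCoords n' b c F) b + - F c ≡ S F (suc b) - + 2 * F c
    atB (inj₂ rfl) rewrite S-σ-below c NP.≤-refl = ring (S F c) (F c)
      where ring : ∀ a b → a + - b ≡ a + b - + 2 * b
            ring = solve-∀
    atB (inj₁ c<b) with pred-split c<b
    ... | k , e , ck = subst (λ z → S (σCoords n' b c F) z + - F c ≡ S F (suc z) - + 2 * F c) (sym e)
           (trans (cong (_+ - F c) (S-σ-shifted k ck (subst (k <_) (sym e) (NP.n<1+n k))))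
                  (ring (S F (suc (suc k))) (F c)))
      where ring : ∀ a b → a - b + - b ≡ a - + 2 * b
            ring = solve-∀
  ... | inj₁ bm with m
  ...   | suc m' rewrite S-σ-above m' (NP.≤-pred bm) (NP.<⇒≤ q) | σ-above m' (NP.≤-pred bm) q =
    ring (S F (suc m')) (F c) (F (suc m'))
    where ring : ∀ a b c → a - + 2 * b + c ≡ a + c - + 2 * b
          ring = solve-∀

¬0≤neg : ∀ {k} → + 0 ℤ.≤ -[1+ k ] → ⊥
¬0≤neg ()

¬pos≤0 : ∀ {k} → + suc k ℤ.≤ + 0 → ⊥
¬pos≤0 (+≤+ ())

sign≢0 : ∀ {s} → IsSign s → s ≢ + 0
sign≢0 (inj₁ rfl) ()
sign≢0 (inj₂ rfl) ()

S-zero⇒zero : ∀ (F : ℕ → ℤ) n → (∀ m → m ≤ n → S F m ≡ + 0) → ∀ a → a < n → F a ≡ + 0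
S-zero⇒zero F n h a p = trans (cancel (S F a) (F a)) (cong₂ _-_ (h (suc a) p) (h a (NP.<⇒≤ p)))
  where cancel : ∀ x y → y ≡ (x + y) - x
        cancel = solve-∀

coef-from-coords : ∀ {n} (γ κ : Coef n) F G → Coords (toVec γ) F → Coords (toVec κ) G →
                   (∀ m → F m ≡ G m) → ∀ k → γ k ≡ κ k
coef-from-coords γ κ F G rγ rκ e = toVec-injective γ κ (λ l → trans (rγ l) (trans (e (toℕ l)) (sym (rκ l))))

shortRoot-at : ∀ s a t d → a ≢ d → shortRoot s a t d a ≡ s
shortRoot-at s a t d ad rewrite E-same a | E-diff d a ad = ring s t
  where ring : ∀ s t → s * + 1 + t * + 0 ≡ s
        ring = solve-∀

shortRoot-off : ∀ s a t d g → g ≢ a → g ≢ d → shortRoot s a t d g ≡ + 0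
shortRoot-off s a t d g ga gd rewrite E-diff a g ga | E-diff d g gd = ring s t
  where ring : ∀ s t → s * + 0 + t * + 0 ≡ + 0
        ring = solve-∀

shortRoot-comm : ∀ s a t d m → shortRoot s a t d m ≡ shortRoot t d s a m
shortRoot-comm s a t d m = ZP.+-comm (s * E a m) (t * E d m)

shortRoot-total : ∀ s a t d N → a < N → d < N → S (shortRoot s a t d) N ≡ s + t
shortRoot-total s a t d N aN dN rewrite S-shortRoot s a t d N | S-E-> a N aN | S-E-> d N dN = ring s t
  where ring : ∀ s t → s * + 1 + t * + 1 ≡ s + t
        ring = solve-∀

shortRoot-before : ∀ s a t d → d < a → S (shortRoot s a t d) (suc d) ≡ t
shortRoot-before s a t d p rewrite S-shortRoot s a t d (suc d) | S-E-≤ a (suc d) p | S-E-> d (suc d) (NP.n<1+n d) =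
  ring s t
  where ring : ∀ s t → s * + 0 + t * + 1 ≡ t
        ring = solve-∀

-- Throughout: n = n'+1, i = c+1, j = b+2 with c ≤ b < n'.
module Fixed (n' b c : ℕ) (cb : c ≤ b) (bn : b < n') where
  N : ℕ
  N = suc n'

  cn : c ≤ n'
  cn = NP.≤-trans cb (NP.<⇒≤ bn)

  c<N : c < N
  c<N = s≤s cn

  γ₂v : Vec N
  γ₂v = toVec (γ₂ {N} (suc c))

  reflγ₂-coords : ∀ (v : Vec N) F → Coords v F → Coords (refl γ₂v v) (negEntry c F)
  reflγ₂-coords v F r = reflLong c γ₂v v F c<N (γ₂-coords n' c cn) r

  σw : Word N
  σw = σW {N} (suc c) (suc (suc b))

  ht₁ : ℕ
  ht₁ = (suc b ∸ c) ℕ.+ 2 ℕ.* (n' ∸ suc b) ℕ.+ 1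

  htγ₁ : ht (γ₁ {N} (suc c) (suc (suc b))) ≡ ht₁
  htγ₁ = ht-γ n' c (suc b) (NP.≤-trans cb (NP.n≤1+n b)) bn

  -- The sign conditions of part (1) on coordinates F of γ:
  -- γ > 0 and s_{γ₂}(γ) < 0, where s_{γ₂} negates the entry c.
  Positive : (ℕ → ℤ) → Set
  Positive F = ∀ m → m ≤ N → + 0 ℤ.≤ S F m

  ReflNegative : (ℕ → ℤ) → Set
  ReflNegative F = ∀ m → m ≤ N → S (negEntry c F) m ℤ.≤ + 0

  Positive-ext : ∀ F G → (∀ k → F k ≡ G k) → Positive F → Positive G
  Positive-ext F G e pos m p = subst (+ 0 ℤ.≤_) (S-cong F G m (λ k _ → e k)) (pos m p)

  ReflNegative-ext : ∀ F G → (∀ k → F k ≡ G k) → ReflNegative F → ReflNegative G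
  ReflNegative-ext F G e neg m p =
    subst (ℤ._≤ + 0)
      (S-cong (negEntry c F) (negEntry c G) m (λ k _ → cong₂ (λ u w → u - (+ 2 * w) * E c k) (e k) (e c)))
      (neg m p)

  positive : ∀ (γ : Coef N) F → Coords (toVec γ) F → Positive F
  positive γ F rv = pos⇒partialSums≥0 (toVec γ) F rv (γ , λ l → rfl)

  reflNegative : ∀ (v : Vec N) F → Coords v F → Neg (refl γ₂v v) → ReflNegative F
  reflNegative v F rv (_ , negx) = neg⇒partialSums≤0 (refl γ₂v v) (negEntry c F) (reflγ₂-coords v F rv) negx

  γBetween : Coef N → Set
  γBetween γ = Σ[ q ∈ ℕ ] c < q × q ≤ suc b × (∀ k → γ k ≡ γ[_,_] {N} (suc c) (suc q) k)

  -- If the entry c of γ vanishes, s_{γ₂} fixes γ, and the two conditions force γ = 0.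
  zero-at-c : ∀ F → F c ≡ + 0 → Positive F → ReflNegative F → ∀ a → a < N → F a ≡ + 0
  zero-at-c F Fc pos neg = S-zero⇒zero F N (λ m p →
      ZP.≤-antisym (subst (ℤ._≤ + 0) (S-cong (negEntry c F) F m (λ k _ → fixed k)) (neg m p)) (pos m p))
    where
    fixed : ∀ k → negEntry c F k ≡ F k
    fixed k rewrite Fc = ring (F k) (E c k)
      where ring : ∀ f e → f - (+ 2 * + 0) * e ≡ f
            ring = solve-∀

  -- e_c + e_d with c < d is γ[c+1, d+1]; the height bound forces d ≤ b+1.
  short-plus : (γ : Coef N) (d : ℕ) → c < d → d < N → Coords (toVec γ) (shortRoot (+ 1) c (+ 1) d) →
               ht₁ ≤ ht γ → γBetween γ
  short-plus γ d cd dN rv h1 = d , cd , d≤b+1 , eqγ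
    where
    dn : d ≤ n'
    dn = NP.≤-pred dN
    eqγ : ∀ k → γ k ≡ γ[_,_] {N} (suc c) (suc d) k
    eqγ = coef-from-coords γ _ _ (λ m → E c m + E d m) rv (γ-coords n' c d (NP.<⇒≤ cd) dn)
            (λ m → unit (E c m) (E d m))
      where unit : ∀ x y → + 1 * x + + 1 * y ≡ x + y
            unit = solve-∀
    htγ : ht γ ≡ (d ∸ c) ℕ.+ 2 ℕ.* (n' ∸ d) ℕ.+ 1
    htγ = trans (ht-cong γ _ eqγ) (ht-γ n' c d (NP.<⇒≤ cd) dn)
    d≤b+1 : d ≤ suc b
    d≤b+1 with d ℕ.≤? suc b
    ... | yes q = q
    ... | no q = ⊥-elim (NP.<-irrefl rfl (NP.<-≤-trans (subst (_< ht₁) (sym htγ) too-low) h1))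
      where too-low = ht-γ-anti c (suc b) d n' (NP.≤-trans cb (NP.n≤1+n b)) (NP.≰⇒> q) dn

  -- e_c − e_d with c < d is a sum of simple roots α, too low to reach ht γ₁.
  short-minus : (γ : Coef N) (d : ℕ) → c < d → d < N → Coords (toVec γ) (shortRoot (+ 1) c (- (+ 1)) d) →
                ht₁ ≤ ht γ → ⊥
  short-minus γ d cd dN rv h1 =
    NP.<-irrefl rfl (NP.<-≤-trans (subst (_< ht₁) (sym htγ) too-low) h1)
    where
    dn : d ≤ n'
    dn = NP.≤-pred dN
    eqγ : ∀ k → γ k ≡ sumα {N} (suc c) (suc d) k
    eqγ = coef-from-coords γ _ _ (λ m → E c m - E d m) rv (sumα-coords n' c d (NP.<⇒≤ cd) dn)
            (λ m → unit (E c m) (E d m))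
      where unit : ∀ x y → + 1 * x + - (+ 1) * y ≡ x - y
            unit = solve-∀
    htγ : ht γ ≡ d ∸ c
    htγ = trans (ht-cong γ _ eqγ) (ht-sumα n' c d (NP.<⇒≤ cd) dn)
    too-low = ht-sumα<ht-γ c d (suc b) n' (NP.<⇒≤ cd) dn (NP.≤-trans cb (NP.n≤1+n b)) bn

  classify-short-at-c : (γ : Coef N) (s t : ℤ) (d : ℕ) → d < N → IsSign s → IsSign t → d ≢ c →
                        Coords (toVec γ) (shortRoot s c t d) → ht₁ ≤ ht γ →
                        Positive (shortRoot s c t d) → ReflNegative (shortRoot s c t d) → γBetween γ
  classify-short-at-c γ s t d dN ss st dc rv h1 pos neg = signs ss st
    where
    F = shortRoot s c t d
    total : S F N ≡ s + t
    total = shortRoot-total s c t d N c<N dN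
    totalRefl : S (negEntry c F) N ≡ (s + t) - + 2 * s
    totalRefl = trans (S-sub-E-> F (+ 2 * F c) c N c<N)
                      (cong₂ _-_ total (cong (+ 2 *_) (shortRoot-at s c t d (λ e → dc (sym e)))))
    before : d < c → S F (suc d) ≡ t
    before = shortRoot-before s c t d
    beforeRefl : d < c → S (negEntry c F) (suc d) ≡ t
    beforeRefl p = trans (S-sub-E-≤ F (+ 2 * F c) c (suc d) p) (before p)
    signs : IsSign s → IsSign t → γBetween γ
    signs (inj₂ rfl) (inj₁ rfl) = ⊥-elim (¬pos≤0 (subst (ℤ._≤ + 0) totalRefl (neg N NP.≤-refl)))
    signs (inj₂ rfl) (inj₂ rfl) = ⊥-elim (¬0≤neg (subst (+ 0 ℤ.≤_) total (pos N NP.≤-refl)))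
    signs (inj₁ rfl) (inj₁ rfl) with NP.<-cmp d c
    ... | tri< p _ _ = ⊥-elim (¬pos≤0 (subst (ℤ._≤ + 0) (beforeRefl p) (neg (suc d) dN)))
    ... | tri≈ _ p _ = ⊥-elim (dc p)
    ... | tri> _ _ p = short-plus γ d p dN rv h1
    signs (inj₁ rfl) (inj₂ rfl) with NP.<-cmp d c
    ... | tri< p _ _ = ⊥-elim (¬0≤neg (subst (+ 0 ℤ.≤_) (before p) (pos (suc d) dN)))
    ... | tri≈ _ p _ = ⊥-elim (dc p)
    ... | tri> _ _ p = ⊥-elim (short-minus γ d p dN rv h1)

  -- A short root meeting the hypotheses of part (1) must involve e_c; reduce to the case above.
  classify-short : (γ : Coef N) (a d : ℕ) (s t : ℤ) → a < N → d < N → a ≢ d → IsSign s → IsSign t →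
                   Coords (toVec γ) (shortRoot s a t d) → ht₁ ≤ ht γ →
                   Positive (shortRoot s a t d) → ReflNegative (shortRoot s a t d) → γBetween γ
  classify-short γ a d s t aN dN ad ss st rv h1 pos neg with a ℕ.≟ c | d ℕ.≟ c
  ... | yes ac | _ =
    classify-short-at-c γ s t d dN ss st (λ dc → ad (trans ac (sym dc)))
      (Coords-ext _ F G same rv) h1 (Positive-ext F G same pos) (ReflNegative-ext F G same neg)
    where
    F = shortRoot s a t d
    G = shortRoot s c t d
    same : ∀ k → F k ≡ G k
    same k = cong (λ z → shortRoot s z t d k) ac
  ... | no _ | yes dc =
    classify-short-at-c γ t s a aN st ss (λ ac → ad (trans ac (sym dc)))
      (Coords-ext _ F G same rv) h1 (Positive-ext F G same pos) (ReflNegative-ext F G same neg)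
    where
    F = shortRoot s a t d
    G = shortRoot t c s a
    same : ∀ k → F k ≡ G k
    same k = trans (shortRoot-comm s a t d k) (cong (λ z → shortRoot t z s a k) dc)
  ... | no ac | no dc = ⊥-elim (sign≢0 ss (trans (sym (shortRoot-at s a t d ad)) vanishes))
    where
    F = shortRoot s a t d
    vanishes : F a ≡ + 0
    vanishes = zero-at-c F (shortRoot-off s a t d c (λ e → ac (sym e)) (λ e → dc (sym e))) pos neg a aN

  no-long : (γ : Coef N) (a : ℕ) (s : ℤ) → a < N → IsSign s → ht γ < ht (γ₂ {N} (suc c)) →
            Coords (toVec γ) (longRoot s a) → Positive (longRoot s a) → ReflNegative (longRoot s a) → ⊥
  no-long γ a s aN ss h2 rv pos neg with a ℕ.≟ c
  ... | no ac = sign≢0 ss (ZP.*-cancelˡ-≡ (+ 2) s (+ 0) (trans (sym Fa) (trans vanishes (sym (ZP.*-zeroʳ (+ 2))))))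
    where
    F = longRoot s a
    Fa : F a ≡ + 2 * s
    Fa = trans (cong ((+ 2 * s) *_) (E-same a)) (ZP.*-identityʳ (+ 2 * s))
    vanishes : F a ≡ + 0
    vanishes = zero-at-c F (trans (cong ((+ 2 * s) *_) (E-diff a c (λ e → ac (sym e)))) (ZP.*-zeroʳ (+ 2 * s)))
                 pos neg a aN
  ... | yes ac = sgn ss
    where
    total : S (longRoot s a) N ≡ + 2 * s
    total = trans (S-* (+ 2 * s) (E a) N) (trans (cong ((+ 2 * s) *_) (S-E-> a N aN)) (ZP.*-identityʳ (+ 2 * s)))
    sgn : IsSign s → ⊥
    sgn (inj₂ e) = ¬0≤neg (subst (+ 0 ℤ.≤_) (trans total (cong (+ 2 *_) e)) (pos N NP.≤-refl))
    sgn (inj₁ e) = NP.<-irrefl (ht-cong γ (γ₂ {N} (suc c)) isγ₂) h2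
      where
      isγ₂ : ∀ k → γ k ≡ γ₂ {N} (suc c) k
      isγ₂ = coef-from-coords γ _ _ _ rv (γ₂-coords n' c cn) (λ m → cong₂ (λ y z → (+ 2 * y) * E z m) e ac)

  part1-classify : (γ : Coef N) → IsRoot (toVec γ) → ht₁ ≤ ht γ → ht γ < ht (γ₂ {N} (suc c)) →
                   Neg (refl γ₂v (toVec γ)) → γBetween γ
  part1-classify γ (inj₁ (a , d , s , t , ad , ss , st , e)) h1 h2 negx =
    classify-short γ (toℕ a) (toℕ d) s t (FP.toℕ<n a) (FP.toℕ<n d) (λ z → ad (FP.toℕ-injective z)) ss st
      rv h1 (positive γ F rv) (reflNegative (toVec γ) F rv negx)
    where
    F = shortRoot s (toℕ a) t (toℕ d)
    rv = shortRoot-coords (toVec γ) a d s t e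
  part1-classify γ (inj₂ (a , s , ss , e)) h1 h2 negx =
    ⊥-elim (no-long γ (toℕ a) s (FP.toℕ<n a) ss h2 rv (positive γ F rv) (reflNegative (toVec γ) F rv negx))
    where
    F = longRoot s (toℕ a)
    rv = longRoot-coords (toVec γ) a s e

  -- Part (1), second claim: for γ = γ[c+1, q+1] with q ≤ b, σ(γ) has a positive partial sum.
  part1-σNeg : (γ : Coef N) → γBetween γ → Neg (act σw (toVec γ)) →
               ∀ k → γ k ≡ γ₁ {N} (suc c) (suc (suc b)) k
  part1-σNeg γ (q , cq , qb , eqγ) (_ , negσ) with q ℕ.≟ suc b
  ... | yes rfl = eqγ
  ... | no q≢b+1 with pred-split cq
  ...   | q' , rfl , cq' = ⊥-elim (¬pos≤0 (subst (ℤ._≤ + 0) positiveSum (negSums (suc q') q'+1≤N)))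
    where
    F : ℕ → ℤ
    F m = E c m + E (suc q') m
    rv : Coords (toVec γ) F
    rv l = trans (sumFin-cong _ _ (λ k → cong (λ z → + z * simpleRoot k l) (eqγ k)))
                 (γ-coords n' c (suc q') (NP.<⇒≤ cq) (NP.≤-trans qb bn) l)
    q'<b : q' < b
    q'<b = NP.≤∧≢⇒< (NP.≤-pred qb) (λ z → q≢b+1 (cong suc z))
    q'+1≤N : suc q' ≤ N
    q'+1≤N = NP.≤-trans q'<b (NP.≤-trans (NP.<⇒≤ bn) (NP.n≤1+n n'))
    negSums = neg⇒partialSums≤0 (act σw (toVec γ)) (σCoords n' b c F) (act-σ n' b c cb bn (toVec γ) F rv) negσ
    positiveSum : S (σCoords n' b c F) (suc q') ≡ + 1
    positiveSum rewrite σValues.S-σ-shifted n' b c F cb bn q' cq' q'<b | S-+ (E c) (E (suc q')) (suc (suc q'))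
                      | S-E-> c (suc (suc q')) (s≤s (NP.<⇒≤ cq)) | S-E-> (suc q') (suc (suc q')) (NP.n<1+n (suc q'))
                      | E-same c | E-diff (suc q') c (λ z → NP.<-irrefl z cq) = rfl

  σ-partialSums≥0 : ∀ F → Positive F → (∀ m → m ≤ N → + 0 ℤ.≤ S (negEntry c F) m) →
                    ∀ m → m ≤ N → + 0 ℤ.≤ S (σCoords n' b c F) m
  σ-partialSums≥0 F SF SX zero p = ZP.≤-refl
  σ-partialSums≥0 F SF SX (suc m) p with m ℕ.<? c
  ... | yes mc = subst (+ 0 ℤ.≤_) (sym (σValues.S-σ-below n' b c F cb bn (suc m) mc)) (SF (suc m) p)
  ... | no mc with m ℕ.<? b
  ...   | yes mb = subst (+ 0 ℤ.≤_) (sym (σValues.S-σ-shifted n' b c F cb bn m (NP.≮⇒≥ mc) mb))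
                     (bySign (ZP.≤-total (F c) (+ 0)))
    where
    m+2≤N : suc (suc m) ≤ N
    m+2≤N = NP.≤-trans (s≤s mb) (NP.≤-trans bn (NP.n≤1+n n'))
    reflSum : + 0 ℤ.≤ S F (suc (suc m)) - + 2 * F c
    reflSum = subst (+ 0 ℤ.≤_) (S-sub-E-> F (+ 2 * F c) c (suc (suc m)) (s≤s (NP.m≤n⇒m≤1+n (NP.≮⇒≥ mc))))
                (SX (suc (suc m)) m+2≤N)
    halfway : ∀ A f → + 0 ℤ.≤ A - + 2 * f → + 0 ℤ.≤ f → + 0 ℤ.≤ A - f
    halfway A f h hf = subst (+ 0 ℤ.≤_) (ring A f) (ZP.+-mono-≤ h hf)
      where ring : ∀ A f → A - + 2 * f + f ≡ A - f
            ring = solve-∀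
    bySign : (F c ℤ.≤ + 0) ⊎ (+ 0 ℤ.≤ F c) → + 0 ℤ.≤ S F (suc (suc m)) - F c
    bySign (inj₁ h) = ZP.+-mono-≤ (SF (suc (suc m)) m+2≤N) (ZP.neg-mono-≤ h)
    bySign (inj₂ h) = halfway (S F (suc (suc m))) (F c) reflSum h
  ...   | no mb = subst (+ 0 ℤ.≤_) (sym (σValues.S-σ-above n' b c F cb bn m (NP.≮⇒≥ mb) (NP.≤-pred p)))
                    (subst (+ 0 ℤ.≤_) (S-sub-E-> F (+ 2 * F c) c (suc m) (s≤s (NP.≮⇒≥ mc))) (SX (suc m) p))

  -- Part (2): σ(γ) is a root, with non-negative partial sums and even total.
  part2 : (γ : Coef N) → IsRoot (toVec γ) → Pos (refl γ₂v (toVec γ)) → Pos (act σw (toVec γ))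
  part2 γ r (_ , posx) =
    act-root σw v r ,
    pos-fromPartialSums (act σw v) (σCoords n' b c F) M (act-σ n' b c cb bn v F rv)
      (σ-partialSums≥0 F (positive γ F rv) (pos⇒partialSums≥0 x (negEntry c F) rx posx)) total
    where
    v = toVec γ
    F = coords γ
    rv = toVec-coords γ
    x = refl γ₂v v
    rx = reflγ₂-coords v F rv
    even = pos⇒total-even x (negEntry c F) rx posx
    M = proj₁ even
    total : S (σCoords n' b c F) N ≡ + M * + 2
    total = trans (σValues.S-σ-above n' b c F cb bn n' (NP.<⇒≤ bn) NP.≤-refl)
                  (trans (sym (S-sub-E-> F (+ 2 * F c) c N c<N)) (proj₂ even))

-- Lemma 3.5.  Write i = c+1, j = b+2, n = n'+1; the cases excluded by
-- 1 ≤ i < j ≤ n are vacuous.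
lemma3p5 : (n : ℕ) → 1 < n → (i j : ℕ) → 1 ≤ i → i < j → j ≤ n →
    (w : Word n) →
    Neg (act w (toVec (γ₁ {n} i j))) → Neg (act w (toVec (γ₂ {n} i))) →
    (w₁ w₂ : Word n) → w ≈W (w₁ ++ (σW i j ++ w₂)) →
    w₁ ≤B ascα 1 (j ∸ 2) → w₂ ≤B descα (i ∸ 2) 1 →
    ((γ : Coef n) → IsRoot (toVec γ) →
       ht (γ₁ {n} i j) ≤ ht γ → ht γ < ht (γ₂ {n} i) →
       Neg (refl (toVec (γ₂ {n} i)) (toVec γ)) →
       (Σ[ p ∈ ℕ ] i < p × p ≤ j × (∀ k → γ k ≡ γ[_,_] {n} i p k))
       × (Neg (act (σW i j) (toVec γ)) → ∀ k → γ k ≡ γ₁ {n} i j k))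
    × ((γ : Coef n) → IsRoot (toVec γ) →
       ht (γ₁ {n} i j) ≤ ht γ →
       Pos (refl (toVec (γ₂ {n} i)) (toVec γ)) →
       Pos (act (σW i j) (toVec γ)))
lemma3p5 n _ zero j () _ _ _ _ _ _ _ _ _ _
lemma3p5 n _ (suc c) zero _ () _ _ _ _ _ _ _ _ _
lemma3p5 n _ (suc c) (suc zero) _ (s≤s ()) _ _ _ _ _ _ _ _ _
lemma3p5 zero _ (suc c) (suc (suc b)) _ _ () _ _ _ _ _ _ _ _
lemma3p5 (suc n') _ (suc c) (suc (suc b)) _ (s≤s (s≤s cb)) (s≤s bn) _ _ _ _ _ _ _ _ =
  part1 , λ γ r _ posx → part2 γ r posx
  where
  open Fixed n' b c cb bn
  part1 = λ γ r h1 h2 negx →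
    let (q , cq , qb , eqγ) = part1-classify γ r (subst (_≤ ht γ) htγ₁ h1) h2 negx
    in (suc q , s≤s cq , s≤s qb , eqγ) , part1-σNeg γ (q , cq , qb , eqγ)
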